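{- Let $f=(A,B,C)$ and $f'=(A',B',C')$ be two partially reduced imaginary or unusual binary quadratic forms over $\mathbb{F}_q[t]$ of the same discriminant. Then: (1) If $|A|<|C|$ and $|A'|<|C'|$, then $f$ and $f'$ are equivalent if and only if $f=f'$. (2) If $|A|<|C|$ and $|A'|=|C'|$, then $f$ and $f'$ are not equivalent. (3) If $|A|=|C|$ and $|A'|=|C'|$, then $f$ and $f'$ are equivalent with $f'=f\circ M$ if and only if $M=\begin{pmatrix}\alpha&\beta\\ 4u\beta/h & u\alpha\end{pmatrix}$ where $\alpha,\beta\in\mathbb{F}_q$, $\alpha^2-(4/h)\beta^2=1$, $u:=\det(M)=\pm1$, and if $B'\neq 0$ then $u$ is determined by the condition $\mathrm{sgn}(B')\in S$.
   Context: Let $q$ be a power of a prime $p\ge 5$. For nonzero $H\in\mathbb{F}_q[t]$ put $|H|=q^{\deg H}$ (and $|0|=0$), and let $\mathrm{sgn}(H)$ denote the leading coefficient of $H$. Fix a primitive root $h$ of $\mathbb{F}_q^*$ and set $S=\{h^i:0\le i\le (q-3)/2\}$. A binary quadratic form $f=(A,B,C)$ is $Ax^2+Bxy+Cy^2$ with $A,B,C\in\mathbb{F}_q[t]$, with discriminant $D=B^2-4AC$. All forms are assumed primitive, irreducible over $\mathbb{F}_q[t]$, with nonzero discriminant, and $D\notin\mathbb{F}_q$. $D$ is imaginary if $\deg D$ is odd, unusual if $\deg D$ is even and $\mathrm{sgn}(D)$ is a non-square in $\mathbb{F}_q^*$. Discriminants are normalized so that $\mathrm{sgn}(D)\in\{1,h\}$.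 For $M=\begin{pmatrix}\alpha&\beta\\ \gamma&\delta\end{pmatrix}$, $(f\circ M)(x,y)=f(\alpha x+\beta y,\gamma x+\delta y)$; $f,g$ are equivalent if $g=f\circ M$ for some $M\in GL_2(\mathbb{F}_q[t])$ (determinant in $\mathbb{F}_q^*$). An imaginary or unusual form $(A,B,C)$ is partially reduced if: (1) $|B|<|A|\le|C|$; (2) if $|A|<|C|$ then $\mathrm{sgn}(A)\in\{1,h\}$, and if $|A|=|C|$ then $\mathrm{sgn}(A)=1$; (3) $B\neq0$ implies $\mathrm{sgn}(B)\in S$. -}

module Defs where

open import Level using (Level; _⊔_)
open import Data.Nat as ℕ using (ℕ; zero; suc; _∸_; _/_)
open import Data.Fin using (Fin)
open import Data.List using (List; []; _∷_; map)
open import Data.Product using (Σ; ∃; ∃-syntax; _×_; _,_)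
open import Data.Sum using (_⊎_)
open import Relation.Nullary using (¬_)
open import Relation.Binary.PropositionalEquality as ≡ using (_≡_)
open import Function.Bundles using (Inverse)
open import Algebra.Bundles using (CommutativeRing)

module RingNotions {c ℓ} (R : CommutativeRing c ℓ) where
  open CommutativeRing R

  natC : ℕ → Carrier
  natC zero    = 0#
  natC (suc n) = 1# + natC n

  pow : Carrier → ℕ → Carrier
  pow x zero    = 1#
  pow x (suc n) = x * pow x n

  record IsFiniteField (q : ℕ) : Set (c ⊔ ℓ) where
    field
      1≉0     : ¬ (1# ≈ 0#)
      _⁻¹     : Carrier → Carrier
      inverse : ∀ x → ¬ (x ≈ 0#) → x * (x ⁻¹) ≈ 1#
      card    : Inverse setoid (≡.setoid (Fin q))

  HasChar : ℕ → Set ℓ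
  HasChar p = natC p ≈ 0#

  IsPrimitiveRoot : Carrier → Set (c ⊔ ℓ)
  IsPrimitiveRoot h = ¬ (h ≈ 0#) × (∀ x → ¬ (x ≈ 0#) → ∃[ i ] (x ≈ pow h i))

  IsSquare : Carrier → Set (c ⊔ ℓ)
  IsSquare a = ∃[ y ] (y * y ≈ a)

-- Polynomials in F_q[t] (coefficient lists, lowest degree first),
-- binary quadratic forms, and the notions of the paper.
-- Parameters: the ring R, an inverse map _⁻¹, q = |F_q|, primitive root h.

module Forms {c ℓ} (R : CommutativeRing c ℓ) (_⁻¹ : CommutativeRing.Carrier R → CommutativeRing.Carrier R)
             (q : ℕ) (h : CommutativeRing.Carrier R) where
  open CommutativeRing R
  open RingNotions R

  Poly : Set c
  Poly = List Carrier

  coeff : Poly → ℕ → Carrier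
  coeff []      n       = 0#
  coeff (a ∷ P) zero    = a
  coeff (a ∷ P) (suc n) = coeff P n

  infix 4 _≈ₚ_
  _≈ₚ_ : Poly → Poly → Set ℓ
  P ≈ₚ Q = ∀ n → coeff P n ≈ coeff Q n

  const : Carrier → Poly
  const a = a ∷ []

  infixl 6 _+ₚ_ _-ₚ_
  infixl 7 _*ₚ_
  _+ₚ_ : Poly → Poly → Poly
  []      +ₚ Q       = Q
  (a ∷ P) +ₚ []      = a ∷ P
  (a ∷ P) +ₚ (b ∷ Q) = (a + b) ∷ (P +ₚ Q)

  negₚ : Poly → Poly
  negₚ = map (-_)

  _-ₚ_ : Poly → Poly → Poly
  P -ₚ Q = P +ₚ negₚ Q

  scale : Carrier → Poly → Poly
  scale a = map (a *_)

  _*ₚ_ : Poly → Poly → Poly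
  []      *ₚ Q = []
  (a ∷ P) *ₚ Q = scale a Q +ₚ (0# ∷ (P *ₚ Q))

  IsZero : Poly → Set ℓ
  IsZero P = ∀ n → coeff P n ≈ 0#

  Deg : Poly → ℕ → Set ℓ
  Deg P d = ¬ (coeff P d ≈ 0#) × (∀ m → d ℕ.< m → coeff P m ≈ 0#)

  Sgn : Poly → Carrier → Set ℓ
  Sgn P a = ∃[ d ] (Deg P d × coeff P d ≈ a)

  HasAbs : Poly → ℕ → Set ℓ
  HasAbs P m = (IsZero P × m ≡ 0) ⊎ (∃[ d ] (Deg P d × m ≡ q ℕ.^ d))

  AbsLt AbsLe AbsEq : Poly → Poly → Set ℓ
  AbsLt P Q = ∃[ m ] ∃[ n ] (HasAbs P m × HasAbs Q n × m ℕ.< n)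
  AbsLe P Q = ∃[ m ] ∃[ n ] (HasAbs P m × HasAbs Q n × m ℕ.≤ n)
  AbsEq P Q = ∃[ m ] ∃[ n ] (HasAbs P m × HasAbs Q n × m ≡ n)

  _∣ₚ_ : Poly → Poly → Set (c ⊔ ℓ)
  P ∣ₚ Q = ∃[ T ] (Q ≈ₚ P *ₚ T)

  IsUnitₚ : Poly → Set (c ⊔ ℓ)
  IsUnitₚ P = ∃[ u ] (¬ (u ≈ 0#) × P ≈ₚ const u)

  InS : Carrier → Set ℓ
  InS x = ∃[ i ] (i ℕ.≤ (q ∸ 3) / 2 × x ≈ pow h i)

  -- binary quadratic forms A x^2 + B xy + C y^2
  record Form : Set c where
    constructor form
    field A B C : Poly
  open Form public

  infix 4 _≈F_
  _≈F_ : Form → Form → Set ℓ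
  f ≈F g = A f ≈ₚ A g × B f ≈ₚ B g × C f ≈ₚ C g

  two four : Poly
  two  = const (natC 2)
  four = const (natC 4)

  Disc : Form → Poly
  Disc f = B f *ₚ B f -ₚ four *ₚ A f *ₚ C f

  record Mat : Set c where
    constructor mat
    field α β γ δ : Poly
  open Mat public

  det : Mat → Poly
  det M = α M *ₚ δ M -ₚ β M *ₚ γ M

  InGL2 : Mat → Set (c ⊔ ℓ)
  InGL2 M = IsUnitₚ (det M)

  -- (f ∘ M)(x,y) = f(αx + βy, γx + δy)
  infixl 9 _∘F_
  _∘F_ : Form → Mat → Form
  f ∘F M = form
    (A f *ₚ α M *ₚ α M +ₚ B f *ₚ α M *ₚ γ M +ₚ C f *ₚ γ M *ₚ γ M)
    (two *ₚ A f *ₚ α M *ₚ β M +ₚ B f *ₚ (α M *ₚ δ M +ₚ β M *ₚ γ M) +ₚ two *ₚ C f *ₚ γ M *ₚ δ M)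
    (A f *ₚ β M *ₚ β M +ₚ B f *ₚ β M *ₚ δ M +ₚ C f *ₚ δ M *ₚ δ M)

  Equivalent : Form → Form → Set (c ⊔ ℓ)
  Equivalent f g = ∃[ M ] (InGL2 M × g ≈F f ∘F M)

  Primitive : Form → Set (c ⊔ ℓ)
  Primitive f = ∀ P → P ∣ₚ A f → P ∣ₚ B f → P ∣ₚ C f → IsUnitₚ P

  Irreducible : Form → Set (c ⊔ ℓ)
  Irreducible f = ¬ (∃[ a ] ∃[ b ] ∃[ c' ] ∃[ d ]
    (A f ≈ₚ a *ₚ c' × B f ≈ₚ a *ₚ d +ₚ b *ₚ c' × C f ≈ₚ b *ₚ d))

  Imaginary : Form → Set ℓ
  Imaginary f = ∃[ d ] (Deg (Disc f) d × ∃[ k ] (d ≡ suc (2 ℕ.* k)))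

  Unusual : Form → Set (c ⊔ ℓ)
  Unusual f = ∃[ d ] (Deg (Disc f) d × ∃[ k ] (d ≡ 2 ℕ.* k) × ¬ IsSquare (coeff (Disc f) d))

  Standing : Form → Set (c ⊔ ℓ)
  Standing f =
      Primitive f
    × Irreducible f
    × ¬ IsZero (Disc f)
    × (∃[ d ] (1 ℕ.≤ d × ¬ (coeff (Disc f) d ≈ 0#)))
    × (Sgn (Disc f) 1# ⊎ Sgn (Disc f) h)
    × (Imaginary f ⊎ Unusual f)

  SgnInS : Poly → Set (c ⊔ ℓ)
  SgnInS P = ¬ IsZero P → ∃[ s ] (Sgn P s × InS s)

  PartiallyReduced : Form → Set (c ⊔ ℓ)
  PartiallyReduced f =
      AbsLt (B f) (A f) × AbsLe (A f) (C f)
    × (AbsLt (A f) (C f) → Sgn (A f) 1# ⊎ Sgn (A f) h)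
    × (AbsEq (A f) (C f) → Sgn (A f) 1#)
    × SgnInS (B f)

  SpecialShape : Poly → Mat → Set (c ⊔ ℓ)
  SpecialShape B' M = ∃[ a ] ∃[ b ] ∃[ u ]
      ( α M ≈ₚ const a
      × β M ≈ₚ const b
      × γ M ≈ₚ const (natC 4 * u * b * (h ⁻¹))
      × δ M ≈ₚ const (u * a)
      × a * a - natC 4 * (h ⁻¹) * (b * b) ≈ 1#
      × (u ≈ 1# ⊎ u ≈ - 1#)
      × det M ≈ₚ const u
      × SgnInS B')

{-# OPTIONS --safe #-}
-- For a partially reduced imaginary or unusual form, deg f(x, y) = max (deg A + 2 deg x, deg C + 2 deg y):
-- the top terms of A x² and C y² could only cancel if deg A + deg C were even and −4 sgn A sgn C a square.
-- If f′ = f ∘ M, then A′ = f(α, γ) and C′ = f(β, δ), while deg A + deg C = deg A′ + deg C′ is the degree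
-- of the common discriminant. Comparing degrees, M is either upper triangular with constant diagonal or,
-- when deg A = deg C, constant. In the first case the normalisation of sgn A (h is not a square) and of
-- sgn B (S and −S are disjoint) leaves only f′ = f. In the second, f ∘ M = f′ says that M preserves the
-- leading form x² − (h/4) y², which unfolds to the shape of M in part (3); conversely every such M
-- keeps f partially reduced.
module Submission where

open import Defs
open import Algebra.Bundles using (CommutativeRing)
open import Data.Nat as ℕ using (ℕ; zero; suc; z≤n; s≤s; _%_; _/_; _≤_; _^_)
import Data.Nat.Properties as ℕP
import Data.Nat.DivMod as DM
open import Data.Nat.Primality using (Prime; prime⇒irreducible; euclidsLemma; prime[2])
open import Data.Nat.Divisibility using (_∣_; divides; ∣1⇒≡1; m%n≡0⇒n∣m; ∣m+n∣m⇒∣n; ∣-trans; ∣⇒≤)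
open import Data.Nat.Tactic.RingSolver using (solve-∀)
open import Data.Integer as ℤ using (ℤ; +_; -[1+_]; _⊖_)
import Data.Integer.Properties as ℤP
open import Data.Fin as Fin using (Fin)
import Data.Fin.Properties as FinP
open import Data.List using ([]; _∷_)
open import Data.Maybe using (Maybe; just; nothing)
open import Data.Product using (∃; ∃-syntax; _×_; _,_; proj₁; proj₂)
open import Data.Sum using (_⊎_; inj₁; inj₂; map)
open import Data.Empty using (⊥; ⊥-elim)
open import Relation.Nullary using (¬_; Dec; yes; no)
open import Relation.Binary.Definitions using (tri<; tri≈; tri>)
open import Relation.Binary.PropositionalEquality as ≡ using (_≡_; _≢_)
open import Function.Bundles using (Inverse; _⇔_; mk⇔)
open import Level using (_⊔_)
open import Algebra.Solver.Ring.AlmostCommutativeRing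

module IntegerRingSolver {c ℓ} (R : CommutativeRing c ℓ) where
  open CommutativeRing R
  open RingNotions R
  open import Relation.Binary.Reasoning.Setoid setoid
  open import Algebra.Properties.Ring ring using (-‿involutive; -‿distribˡ-*; -‿distribʳ-*; -‿+-comm; -0#≈0#)

  natC-+-homo : ∀ m n → natC (m ℕ.+ n) ≈ natC m + natC n
  natC-+-homo zero    n = sym (+-identityˡ _)
  natC-+-homo (suc m) n = trans (+-congˡ (natC-+-homo m n)) (sym (+-assoc _ _ _))

  natC-*-homo : ∀ m n → natC (m ℕ.* n) ≈ natC m * natC n
  natC-*-homo zero    n = sym (zeroˡ _)
  natC-*-homo (suc m) n = begin
    natC (n ℕ.+ m ℕ.* n)              ≈⟨ natC-+-homo n (m ℕ.* n) ⟩
    natC n + natC (m ℕ.* n)           ≈⟨ +-cong (sym (*-identityˡ _)) (natC-*-homo m n) ⟩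
    1# * natC n + natC m * natC n     ≈⟨ sym (distribʳ _ _ _) ⟩
    (1# + natC m) * natC n            ∎

  ⟦_⟧ℤ : ℤ → Carrier
  ⟦ + n      ⟧ℤ = natC n
  ⟦ -[1+ n ] ⟧ℤ = - natC (suc n)

  -‿homo : ∀ i → ⟦ ℤ.- i ⟧ℤ ≈ - ⟦ i ⟧ℤ
  -‿homo (+ zero)  = sym -0#≈0#
  -‿homo (+ suc n) = refl
  -‿homo -[1+ n ]  = sym (-‿involutive _)

  ⊖-homo : ∀ m n → ⟦ m ⊖ n ⟧ℤ ≈ natC m - natC n
  ⊖-homo zero    zero    = sym (-‿inverseʳ 0#)
  ⊖-homo zero    (suc n) = sym (+-identityˡ _)
  ⊖-homo (suc m) zero    = sym (trans (+-congˡ -0#≈0#) (+-identityʳ _))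
  ⊖-homo (suc m) (suc n) = begin
    ⟦ suc m ⊖ suc n ⟧ℤ                  ≈⟨ reflexive (≡.cong ⟦_⟧ℤ (ℤP.[1+m]⊖[1+n]≡m⊖n m n)) ⟩
    ⟦ m ⊖ n ⟧ℤ                          ≈⟨ ⊖-homo m n ⟩
    natC m - natC n                     ≈⟨ sym (+-identityˡ _) ⟩
    0# + (natC m - natC n)              ≈⟨ +-congʳ (sym (-‿inverseʳ 1#)) ⟩
    (1# - 1#) + (natC m - natC n)       ≈⟨ +-assoc _ _ _ ⟩
    1# + (- 1# + (natC m - natC n))     ≈⟨ +-congˡ (sym (+-assoc _ _ _)) ⟩
    1# + ((- 1# + natC m) - natC n)     ≈⟨ +-congˡ (+-congʳ (+-comm _ _)) ⟩
    1# + ((natC m - 1#) - natC n)       ≈⟨ +-congˡ (+-assoc _ _ _) ⟩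
    1# + (natC m + (- 1# - natC n))     ≈⟨ sym (+-assoc _ _ _) ⟩
    (1# + natC m) + (- 1# - natC n)     ≈⟨ +-congˡ (-‿+-comm 1# (natC n)) ⟩
    (1# + natC m) - (1# + natC n)       ∎

  +-homo : ∀ i j → ⟦ i ℤ.+ j ⟧ℤ ≈ ⟦ i ⟧ℤ + ⟦ j ⟧ℤ
  +-homo (+ m)    (+ n)    = natC-+-homo m n
  +-homo (+ m)    -[1+ n ] = ⊖-homo m (suc n)
  +-homo -[1+ m ] (+ n)    = trans (⊖-homo n (suc m)) (+-comm _ _)
  +-homo -[1+ m ] -[1+ n ] = begin
    - natC (suc (suc (m ℕ.+ n)))      ≈⟨ -‿cong (reflexive (≡.cong (λ k → natC (suc k)) (≡.sym (ℕP.+-suc m n)))) ⟩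
    - natC (suc m ℕ.+ suc n)          ≈⟨ -‿cong (natC-+-homo (suc m) (suc n)) ⟩
    - (natC (suc m) + natC (suc n))   ≈⟨ sym (-‿+-comm _ _) ⟩
    - natC (suc m) + - natC (suc n)   ∎

  *-homo : ∀ i j → ⟦ i ℤ.* j ⟧ℤ ≈ ⟦ i ⟧ℤ * ⟦ j ⟧ℤ
  *-homo (+ m) (+ n) = +-*-homo m n
    where
    +-*-homo : ∀ m n → ⟦ + m ℤ.* + n ⟧ℤ ≈ natC m * natC n
    +-*-homo m n = trans (reflexive (≡.cong ⟦_⟧ℤ (≡.sym (ℤP.pos-* m n)))) (natC-*-homo m n)
  *-homo (+ m) -[1+ n ] = begin
    ⟦ + m ℤ.* ℤ.- (+ suc n) ⟧ℤ    ≈⟨ reflexive (≡.cong ⟦_⟧ℤ (≡.sym (ℤP.neg-distribʳ-* (+ m) (+ suc n)))) ⟩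
    ⟦ ℤ.- (+ m ℤ.* + suc n) ⟧ℤ    ≈⟨ -‿homo (+ m ℤ.* + suc n) ⟩
    - ⟦ + m ℤ.* + suc n ⟧ℤ        ≈⟨ -‿cong (*-homo (+ m) (+ suc n)) ⟩
    - (natC m * natC (suc n))     ≈⟨ -‿distribʳ-* _ _ ⟩
    natC m * - natC (suc n)       ∎
  *-homo -[1+ m ] (+ n) = begin
    ⟦ ℤ.- (+ suc m) ℤ.* + n ⟧ℤ    ≈⟨ reflexive (≡.cong ⟦_⟧ℤ (≡.sym (ℤP.neg-distribˡ-* (+ suc m) (+ n)))) ⟩
    ⟦ ℤ.- (+ suc m ℤ.* + n) ⟧ℤ    ≈⟨ -‿homo (+ suc m ℤ.* + n) ⟩
    - ⟦ + suc m ℤ.* + n ⟧ℤ        ≈⟨ -‿cong (*-homo (+ suc m) (+ n)) ⟩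
    - (natC (suc m) * natC n)     ≈⟨ -‿distribˡ-* _ _ ⟩
    - natC (suc m) * natC n       ∎
  *-homo -[1+ m ] -[1+ n ] = begin
    ⟦ + suc m ℤ.* + suc n ⟧ℤ              ≈⟨ *-homo (+ suc m) (+ suc n) ⟩
    natC (suc m) * natC (suc n)           ≈⟨ sym (-‿involutive _) ⟩
    - - (natC (suc m) * natC (suc n))     ≈⟨ -‿cong (-‿distribˡ-* _ _) ⟩
    - (- natC (suc m) * natC (suc n))     ≈⟨ -‿distribʳ-* _ _ ⟩
    - natC (suc m) * - natC (suc n)       ∎

  ℤ⟶R : CommutativeRing.rawRing ℤP.+-*-commutativeRing -Raw-AlmostCommutative⟶ fromCommutativeRing R
  ℤ⟶R = record
    { ⟦_⟧ = ⟦_⟧ℤ ; +-homo = +-homo ; *-homo = *-homo ; -‿homo = -‿homo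
    ; 0-homo = refl ; 1-homo = +-identityʳ 1# }

  ≟ℤ : ∀ i j → Maybe (⟦ i ⟧ℤ ≈ ⟦ j ⟧ℤ)
  ≟ℤ i j with i ℤ.≟ j
  ... | yes ≡.refl = just refl
  ... | no _       = nothing

  open import Algebra.Solver.Ring (CommutativeRing.rawRing ℤP.+-*-commutativeRing) (fromCommutativeRing R) ℤ⟶R ≟ℤ public

module DegreeArithmetic where

  cross-term-bound : ∀ {a c x y N} → a ≤ c → a ℕ.+ x ℕ.+ x ≤ N → c ℕ.+ y ℕ.+ y ≤ N → a ℕ.+ x ℕ.+ y ≤ N
  cross-term-bound {a} {c} {x} {y} a≤c ax≤N cy≤N with ℕP.≤-total x y
  ... | inj₁ x≤y = ℕP.≤-trans (ℕP.+-monoˡ-≤ y (ℕP.+-mono-≤ a≤c x≤y)) cy≤N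
  ... | inj₂ y≤x = ℕP.≤-trans (ℕP.+-monoʳ-≤ (a ℕ.+ x) y≤x) ax≤N

  a+x+x≤a⇒x≡0 : ∀ a x → a ℕ.+ x ℕ.+ x ≤ a → x ≡ 0
  a+x+x≤a⇒x≡0 a x le = ℕP.m+n≡0⇒m≡0 x (ℕP.n≤0⇒n≡0 (ℕP.+-cancelˡ-≤ a (x ℕ.+ x) 0
    (ℕP.≤-trans (ℕP.≤-reflexive (≡.sym (ℕP.+-assoc a x x))) (ℕP.≤-trans le (ℕP.≤-reflexive (≡.sym (ℕP.+-identityʳ a)))))))

  odd≢even : ∀ x y → suc (x ℕ.+ x) ≢ y ℕ.+ y
  odd≢even zero    zero    ()
  odd≢even zero    (suc y) eq with ≡.trans (ℕP.suc-injective eq) (ℕP.+-suc y y)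
  ... | ()
  odd≢even (suc x) zero    ()
  odd≢even (suc x) (suc y) eq = odd≢even x y (ℕP.suc-injective
    (≡.trans (≡.cong suc (≡.sym (ℕP.+-suc x x))) (≡.trans (ℕP.suc-injective eq) (ℕP.+-suc y y))))

  balanced⇒sum-even : ∀ a c x y k → a ℕ.+ x ℕ.+ x ≡ c ℕ.+ y ℕ.+ y → a ℕ.+ c ≢ suc (2 ℕ.* k)
  balanced⇒sum-even a c x y k balanced a+c≡odd = odd≢even (k ℕ.+ x) (c ℕ.+ y) (begin
    suc ((k ℕ.+ x) ℕ.+ (k ℕ.+ x))    ≡⟨ lhs k x ⟩
    suc (2 ℕ.* k) ℕ.+ (x ℕ.+ x)      ≡⟨ ≡.cong (ℕ._+ (x ℕ.+ x)) a+c≡odd ⟨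
    (a ℕ.+ c) ℕ.+ (x ℕ.+ x)          ≡⟨ mid a c x ⟩
    (a ℕ.+ x ℕ.+ x) ℕ.+ c            ≡⟨ ≡.cong (ℕ._+ c) balanced ⟩
    (c ℕ.+ y ℕ.+ y) ℕ.+ c            ≡⟨ rhs c y ⟩
    (c ℕ.+ y) ℕ.+ (c ℕ.+ y)          ∎)
    where
    open ≡.≡-Reasoning
    lhs : ∀ k x → suc ((k ℕ.+ x) ℕ.+ (k ℕ.+ x)) ≡ suc (2 ℕ.* k) ℕ.+ (x ℕ.+ x)
    lhs = solve-∀
    mid : ∀ a c x → (a ℕ.+ c) ℕ.+ (x ℕ.+ x) ≡ (a ℕ.+ x ℕ.+ x) ℕ.+ c
    mid = solve-∀
    rhs : ∀ c y → (c ℕ.+ y ℕ.+ y) ℕ.+ c ≡ (c ℕ.+ y) ℕ.+ (c ℕ.+ y)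
    rhs = solve-∀

  x≤x+y+y : ∀ x y → x ≤ x ℕ.+ y ℕ.+ y
  x≤x+y+y x y = ℕP.≤-trans (ℕP.m≤m+n x y) (ℕP.m≤m+n (x ℕ.+ y) y)

  tight-bounds : ∀ a c a′ c′ x y → a ℕ.+ x ℕ.+ x ≤ a′ → c ℕ.+ y ℕ.+ y ≤ c′ → a ℕ.+ c ≡ a′ ℕ.+ c′ →
                 x ≡ 0 × y ≡ 0 × a′ ≡ a × c′ ≡ c
  tight-bounds a c a′ c′ x y ax≤a′ cy≤c′ sum≡ = x≡0 , y≡0 , a′≡a , c′≡c
    where
    regroup : ∀ a c x y → (a ℕ.+ x ℕ.+ x) ℕ.+ (c ℕ.+ y ℕ.+ y) ≡ (a ℕ.+ c) ℕ.+ ((x ℕ.+ x) ℕ.+ (y ℕ.+ y))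
    regroup = solve-∀
    2x+2y≡0 : (x ℕ.+ x) ℕ.+ (y ℕ.+ y) ≡ 0
    2x+2y≡0 = ℕP.n≤0⇒n≡0 (ℕP.+-cancelˡ-≤ (a ℕ.+ c) _ 0
      (ℕP.≤-trans (ℕP.≤-reflexive (≡.sym (regroup a c x y)))
      (ℕP.≤-trans (ℕP.+-mono-≤ ax≤a′ cy≤c′) (ℕP.≤-reflexive (≡.trans (≡.sym sum≡) (≡.sym (ℕP.+-identityʳ _)))))))
    x≡0 = ℕP.m+n≡0⇒m≡0 x (ℕP.m+n≡0⇒m≡0 (x ℕ.+ x) 2x+2y≡0)
    y≡0 = ℕP.m+n≡0⇒m≡0 y (ℕP.m+n≡0⇒n≡0 (x ℕ.+ x) 2x+2y≡0)
    a≤a′ = ℕP.≤-trans (x≤x+y+y a x) ax≤a′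
    c≤c′ = ℕP.≤-trans (x≤x+y+y c y) cy≤c′
    a′≡a = ℕP.≤-antisym (ℕP.+-cancelʳ-≤ c′ a′ a (ℕP.≤-trans (ℕP.≤-reflexive (≡.sym sum≡)) (ℕP.+-monoʳ-≤ a c≤c′))) a≤a′
    c′≡c = ℕP.≤-antisym (ℕP.+-cancelˡ-≤ a′ c′ c (ℕP.≤-trans (ℕP.≤-reflexive (≡.sym sum≡)) (ℕP.+-monoˡ-≤ c a≤a′))) c≤c′

  squeezed-bounds : ∀ a c a′ c′ y → c ℕ.+ y ℕ.+ y ≤ a′ → a′ ≤ c′ → a ℕ.+ c ≡ a′ ℕ.+ c′ → a ≤ c →
                    y ≡ 0 × a′ ≡ c × a ≡ c × c′ ≡ c
  squeezed-bounds a c a′ c′ y cy≤a′ a′≤c′ sum≡ a≤c = y≡0 , a′≡c , a≡c , c′≡c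
    where
    regroup : ∀ c y → (c ℕ.+ y ℕ.+ y) ℕ.+ (c ℕ.+ y ℕ.+ y) ≡ (c ℕ.+ c) ℕ.+ ((y ℕ.+ y) ℕ.+ (y ℕ.+ y))
    regroup = solve-∀
    a′+a′≤c+c : a′ ℕ.+ a′ ≤ c ℕ.+ c
    a′+a′≤c+c = ℕP.≤-trans (ℕP.+-monoʳ-≤ a′ a′≤c′) (ℕP.≤-trans (ℕP.≤-reflexive (≡.sym sum≡)) (ℕP.+-monoˡ-≤ c a≤c))
    4y≡0 : (y ℕ.+ y) ℕ.+ (y ℕ.+ y) ≡ 0
    4y≡0 = ℕP.n≤0⇒n≡0 (ℕP.+-cancelˡ-≤ (c ℕ.+ c) _ 0
      (ℕP.≤-trans (ℕP.≤-reflexive (≡.sym (regroup c y)))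
      (ℕP.≤-trans (ℕP.+-mono-≤ cy≤a′ cy≤a′) (ℕP.≤-trans a′+a′≤c+c (ℕP.≤-reflexive (≡.sym (ℕP.+-identityʳ _)))))))
    y≡0 = ℕP.m+n≡0⇒m≡0 y (ℕP.m+n≡0⇒m≡0 (y ℕ.+ y) 4y≡0)
    c≤a′ = ℕP.≤-trans (x≤x+y+y c y) cy≤a′
    a′≡c : a′ ≡ c
    a′≡c with ℕP.m≤n⇒m<n∨m≡n c≤a′
    ... | inj₂ c≡a′ = ≡.sym c≡a′
    ... | inj₁ c<a′ = ⊥-elim (ℕP.<⇒≱ (ℕP.+-mono-< c<a′ c<a′) a′+a′≤c+c)
    a≡c : a ≡ c
    a≡c = ℕP.≤-antisym a≤c (ℕP.+-cancelʳ-≤ c c a (ℕP.≤-trans (ℕP.≤-reflexive (≡.cong (λ t → t ℕ.+ t) (≡.sym a′≡c)))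
                                                   (ℕP.≤-trans (ℕP.+-monoʳ-≤ a′ a′≤c′) (ℕP.≤-reflexive (≡.sym sum≡)))))
    c′≡c : c′ ≡ c
    c′≡c = ℕP.+-cancelˡ-≡ c c′ c (≡.trans (≡.cong (ℕ._+ c′) (≡.sym a′≡c)) (≡.trans (≡.sym sum≡) (≡.cong (ℕ._+ c) a≡c)))

module Coefficients {c ℓ} (R : CommutativeRing c ℓ) (inv : CommutativeRing.Carrier R → CommutativeRing.Carrier R)
                    (q : ℕ) (h : CommutativeRing.Carrier R) where
  open CommutativeRing R hiding (zero)
  open RingNotions R
  open Forms R inv q h
  open import Algebra.Properties.Ring ring using (-0#≈0#)

  -- deg P < n, where the zero polynomial has degree −∞
  record DegLt (P : Poly) (n : ℕ) : Set ℓ where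
    constructor degLt
    field vanish : ∀ m → n ℕ.≤ m → coeff P m ≈ 0#
  open DegLt public

  -- deg P ≤ d and the coefficient of t^d is v (v may be 0)
  TopCoeff : Poly → ℕ → Carrier → Set ℓ
  TopCoeff P d v = DegLt P (suc d) × coeff P d ≈ v

  coeff-+ : ∀ P Q n → coeff (P +ₚ Q) n ≈ coeff P n + coeff Q n
  coeff-+ []      Q       n       = sym (+-identityˡ _)
  coeff-+ (a ∷ P) []      n       = sym (+-identityʳ _)
  coeff-+ (a ∷ P) (b ∷ Q) zero    = refl
  coeff-+ (a ∷ P) (b ∷ Q) (suc n) = coeff-+ P Q n

  coeff-+₃ : ∀ P Q T n → coeff (P +ₚ Q +ₚ T) n ≈ coeff P n + coeff Q n + coeff T n
  coeff-+₃ P Q T n = trans (coeff-+ (P +ₚ Q) T n) (+-congʳ (coeff-+ P Q n))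

  coeff-neg : ∀ P n → coeff (negₚ P) n ≈ - coeff P n
  coeff-neg []      n       = sym -0#≈0#
  coeff-neg (a ∷ P) zero    = refl
  coeff-neg (a ∷ P) (suc n) = coeff-neg P n

  coeff-- : ∀ P Q n → coeff (P -ₚ Q) n ≈ coeff P n - coeff Q n
  coeff-- P Q n = trans (coeff-+ P (negₚ Q) n) (+-congˡ (coeff-neg Q n))

  coeff-scale : ∀ a P n → coeff (scale a P) n ≈ a * coeff P n
  coeff-scale a []      n       = sym (zeroʳ _)
  coeff-scale a (b ∷ P) zero    = refl
  coeff-scale a (b ∷ P) (suc n) = coeff-scale a P n

  coeff-*-zero : ∀ a P Q → coeff ((a ∷ P) *ₚ Q) zero ≈ a * coeff Q zero
  coeff-*-zero a P Q = trans (coeff-+ (scale a Q) (0# ∷ (P *ₚ Q)) zero)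
                             (trans (+-identityʳ _) (coeff-scale a Q zero))

  coeff-*-suc : ∀ a P Q n → coeff ((a ∷ P) *ₚ Q) (suc n) ≈ a * coeff Q (suc n) + coeff (P *ₚ Q) n
  coeff-*-suc a P Q n = trans (coeff-+ (scale a Q) (0# ∷ (P *ₚ Q)) (suc n))
                              (+-congʳ (coeff-scale a Q (suc n)))

  coeff-*-const : ∀ P Q l n → TopCoeff Q 0 l → coeff (P *ₚ Q) n ≈ coeff P n * l
  coeff-*-const []      Q l n       _        = sym (zeroˡ _)
  coeff-*-const (a ∷ P) Q l zero    (_ , cq) = trans (coeff-*-zero a P Q) (*-congˡ cq)
  coeff-*-const (a ∷ P) Q l (suc n) tq@(sq , _) = begin
    coeff ((a ∷ P) *ₚ Q) (suc n)       ≈⟨ coeff-*-suc a P Q n ⟩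
    a * coeff Q (suc n) + coeff (P *ₚ Q) n ≈⟨ +-cong (trans (*-congˡ (vanish sq (suc n) (s≤s z≤n))) (zeroʳ _))
                                               (coeff-*-const P Q l n tq) ⟩
    0# + coeff P n * l                 ≈⟨ +-identityˡ _ ⟩
    coeff P n * l                      ∎
    where open import Relation.Binary.Reasoning.Setoid setoid

  degLt-mono : ∀ {P n m} → n ℕ.≤ m → DegLt P n → DegLt P m
  degLt-mono n≤m (degLt s) = degLt λ k m≤k → s k (ℕP.≤-trans n≤m m≤k)

  degLt-tail : ∀ {a P n} → DegLt (a ∷ P) (suc n) → DegLt P n
  degLt-tail (degLt s) = degLt λ m n≤m → s (suc m) (s≤s n≤m)

  degLt₀-tail : ∀ {a P} → DegLt (a ∷ P) 0 → DegLt P 0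
  degLt₀-tail (degLt s) = degLt λ m _ → s (suc m) z≤n

  degLt₀-head : ∀ {a P} → DegLt (a ∷ P) 0 → a ≈ 0#
  degLt₀-head (degLt s) = s 0 z≤n

  degLt-≈ₚ : ∀ {P Q n} → P ≈ₚ Q → DegLt P n → DegLt Q n
  degLt-≈ₚ P≈Q sp = degLt λ m le → trans (sym (P≈Q m)) (vanish sp m le)

  degLt-+ : ∀ {P Q n} → DegLt P n → DegLt Q n → DegLt (P +ₚ Q) n
  degLt-+ {P} {Q} sp sq = degLt λ m le →
    trans (coeff-+ P Q m) (trans (+-cong (vanish sp m le) (vanish sq m le)) (+-identityʳ _))

  degLt-neg : ∀ {P n} → DegLt P n → DegLt (negₚ P) n
  degLt-neg {P} sp = degLt λ m le → trans (coeff-neg P m) (trans (-‿cong (vanish sp m le)) -0#≈0#)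

  zero-*ₚˡ : ∀ P Q → DegLt P 0 → DegLt (P *ₚ Q) 0
  zero-*ₚˡ P Q sp = degLt (go P sp)
    where
    go : ∀ P → DegLt P 0 → ∀ m → 0 ℕ.≤ m → coeff (P *ₚ Q) m ≈ 0#
    go []      sp m       _ = refl
    go (a ∷ P) sp zero    _ = trans (coeff-*-zero a P Q) (trans (*-congʳ (degLt₀-head sp)) (zeroˡ _))
    go (a ∷ P) sp (suc m) _ = trans (coeff-*-suc a P Q m)
      (trans (+-cong (trans (*-congʳ (degLt₀-head sp)) (zeroˡ _)) (go P (degLt₀-tail sp) m z≤n)) (+-identityʳ _))

  zero-*ₚʳ : ∀ P Q → DegLt Q 0 → DegLt (P *ₚ Q) 0
  zero-*ₚʳ P Q sq = degLt (go P)
    where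
    go : ∀ P m → 0 ℕ.≤ m → coeff (P *ₚ Q) m ≈ 0#
    go []      m       _ = refl
    go (a ∷ P) zero    _ = trans (coeff-*-zero a P Q) (trans (*-congˡ (vanish sq 0 z≤n)) (zeroʳ _))
    go (a ∷ P) (suc m) _ = trans (coeff-*-suc a P Q m)
      (trans (+-cong (trans (*-congˡ (vanish sq (suc m) z≤n)) (zeroʳ _)) (go P m z≤n)) (+-identityʳ _))

  degLt-* : ∀ P Q n e → DegLt P n → DegLt Q (suc e) → DegLt (P *ₚ Q) (n ℕ.+ e)
  degLt-* P Q n e sp sq = degLt (go P n sp)
    where
    go : ∀ P n → DegLt P n → ∀ m → n ℕ.+ e ℕ.≤ m → coeff (P *ₚ Q) m ≈ 0#
    go []      n       sp m       _  = refl
    go (a ∷ P) zero    sp m       _  = vanish (zero-*ₚˡ (a ∷ P) Q sp) m z≤n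
    go (a ∷ P) (suc n) sp (suc m) (s≤s le) = trans (coeff-*-suc a P Q m)
      (trans (+-cong (trans (*-congˡ (vanish sq (suc m) (s≤s (ℕP.≤-trans (ℕP.m≤n+m e n) le)))) (zeroʳ _))
                     (go P n (degLt-tail sp) m le))
             (+-identityʳ _))

  degLt-*-diag : ∀ P Q n → DegLt P n → DegLt Q n → DegLt (P *ₚ Q) (n ℕ.+ n)
  degLt-*-diag P Q zero    sp sq = zero-*ₚˡ P Q sp
  degLt-*-diag P Q (suc n) sp sq =
    degLt-mono (ℕP.+-monoʳ-≤ (suc n) (ℕP.n≤1+n n)) (degLt-* P Q (suc n) n sp sq)

  coeff-*-top : ∀ P Q d e → DegLt P (suc d) → DegLt Q (suc e) → coeff (P *ₚ Q) (d ℕ.+ e) ≈ coeff P d * coeff Q e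
  coeff-*-top []      Q d       e       sp sq = sym (zeroˡ _)
  coeff-*-top (a ∷ P) Q zero    zero    sp sq = coeff-*-zero a P Q
  coeff-*-top (a ∷ P) Q zero    (suc e) sp sq = trans (coeff-*-suc a P Q e)
    (trans (+-congˡ (vanish (zero-*ₚˡ P Q (degLt-tail sp)) e z≤n)) (+-identityʳ _))
  coeff-*-top (a ∷ P) Q (suc d) e       sp sq = trans (coeff-*-suc a P Q (d ℕ.+ e))
    (trans (+-congʳ (trans (*-congˡ (vanish sq (suc (d ℕ.+ e)) (s≤s (ℕP.m≤n+m e d)))) (zeroʳ _)))
           (trans (+-identityˡ _) (coeff-*-top P Q d e (degLt-tail sp) sq)))

  top-* : ∀ {P Q d e u v} → TopCoeff P d u → TopCoeff Q e v → TopCoeff (P *ₚ Q) (d ℕ.+ e) (u * v)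
  top-* {P} {Q} {d} {e} (sp , cp) (sq , cq) =
    degLt-* P Q (suc d) e sp sq , trans (coeff-*-top P Q d e sp sq) (*-cong cp cq)

  top-+ : ∀ {P Q d u v} → TopCoeff P d u → TopCoeff Q d v → TopCoeff (P +ₚ Q) d (u + v)
  top-+ {P} {Q} {d} (sp , cp) (sq , cq) = degLt-+ sp sq , trans (coeff-+ P Q d) (+-cong cp cq)

  top-neg : ∀ {P d u} → TopCoeff P d u → TopCoeff (negₚ P) d (- u)
  top-neg {P} {d} (sp , cp) = degLt-neg sp , trans (coeff-neg P d) (-‿cong cp)

  top-const : ∀ a → TopCoeff (const a) 0 a
  top-const a = degLt (λ { (suc m) _ → refl }) , refl

  top-subst : ∀ {P d d' u} → d ≡ d' → TopCoeff P d u → TopCoeff P d' u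
  top-subst ≡.refl t = t

  top-≈ : ∀ {P d u v} → u ≈ v → TopCoeff P d u → TopCoeff P d v
  top-≈ u≈v (sp , cp) = sp , trans cp u≈v

  top-≈ₚ : ∀ {P Q d v} → P ≈ₚ Q → TopCoeff P d v → TopCoeff Q d v
  top-≈ₚ P≈Q (sp , cp) = degLt-≈ₚ P≈Q sp , trans (sym (P≈Q _)) cp

  top-unique : ∀ {P d u v} → TopCoeff P d u → TopCoeff P d v → u ≈ v
  top-unique (_ , cu) (_ , cv) = trans (sym cu) cv

  degLt⇒top : ∀ {P n d} → DegLt P n → n ℕ.≤ d → TopCoeff P d 0#
  degLt⇒top sp n≤d = degLt-mono (ℕP.≤-trans n≤d (ℕP.n≤1+n _)) sp , vanish sp _ n≤d

  top-raise : ∀ {P d N u} → TopCoeff P d u → d ℕ.< N → TopCoeff P N 0#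
  top-raise (sp , _) = degLt⇒top sp

  top-0#⇒degLt : ∀ {P d u} → TopCoeff P d u → u ≈ 0# → DegLt P d
  top-0#⇒degLt {P} {d} (sp , cp) u≈0 = degLt vanish′
    where
    vanish′ : ∀ m → d ℕ.≤ m → coeff P m ≈ 0#
    vanish′ m d≤m with ℕP.m≤n⇒m<n∨m≡n d≤m
    ... | inj₁ d<m    = vanish sp m d<m
    ... | inj₂ ≡.refl = trans cp u≈0

  top₀⇒≈const : ∀ {P l} → TopCoeff P 0 l → P ≈ₚ const l
  top₀⇒≈const (sp , cp) zero    = cp
  top₀⇒≈const (sp , cp) (suc n) = vanish sp (suc n) (s≤s z≤n)

module FiniteField {c ℓ} (R : CommutativeRing c ℓ) (q : ℕ) (F : RingNotions.IsFiniteField R q)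
                   (h : CommutativeRing.Carrier R) where
  open CommutativeRing R hiding (zero)
  open RingNotions R
  open IsFiniteField F
  open Forms R _⁻¹ q h
  open Coefficients R _⁻¹ q h public
  open IntegerRingSolver R public
  open import Relation.Binary.Reasoning.Setoid setoid
  open import Algebra.Properties.Ring ring using (-‿distribˡ-*; -‿distribʳ-*; -‿involutive) public
  open Inverse card using (to; from; to-cong; from-cong; inverseˡ; inverseʳ)

  to-injective : ∀ {x y} → to x ≡ to y → x ≈ y
  to-injective eq = trans (sym (inverseʳ ≡.refl)) (trans (from-cong eq) (inverseʳ ≡.refl))

  from-injective : ∀ {i j} → from i ≈ from j → i ≡ j
  from-injective eq = ≡.trans (≡.sym (inverseˡ refl)) (≡.trans (to-cong eq) (inverseˡ refl))

  _≟_ : ∀ x y → Dec (x ≈ y)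
  x ≟ y with to x Fin.≟ to y
  ... | yes eq = yes (to-injective eq)
  ... | no  ne = no λ x≈y → ne (to-cong x≈y)

  2≤q : 2 ℕ.≤ q
  2≤q with 2 ℕ.≤? q
  ... | yes 2≤q = 2≤q
  ... | no  2≰q = ⊥-elim (1≉0 (to-injective (Fin≤1-trivial (ℕP.≤-pred (ℕP.≰⇒> 2≰q)) (to 1#) (to 0#))))
    where
    Fin≤1-trivial : ∀ {n} → n ℕ.≤ 1 → (i j : Fin n) → i ≡ j
    Fin≤1-trivial {suc zero}    _         Fin.zero Fin.zero = ≡.refl
    Fin≤1-trivial {suc (suc n)} (s≤s ()) i j

  *-integral : ∀ {x y} → x * y ≈ 0# → x ≈ 0# ⊎ y ≈ 0#
  *-integral {x} {y} xy≈0 with x ≟ 0#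
  ... | yes x≈0 = inj₁ x≈0
  ... | no  x≉0 = inj₂ (begin
      y                ≈⟨ sym (*-identityˡ y) ⟩
      1# * y           ≈⟨ *-congʳ (sym (trans (*-comm _ _) (inverse x x≉0))) ⟩
      (x ⁻¹ * x) * y   ≈⟨ *-assoc _ _ _ ⟩
      x ⁻¹ * (x * y)   ≈⟨ *-congˡ xy≈0 ⟩
      x ⁻¹ * 0#        ≈⟨ zeroʳ _ ⟩
      0#               ∎)

  *-≉0 : ∀ {x y} → ¬ x ≈ 0# → ¬ y ≈ 0# → ¬ (x * y ≈ 0#)
  *-≉0 x≉0 y≉0 xy≈0 with *-integral xy≈0
  ... | inj₁ x≈0 = x≉0 x≈0
  ... | inj₂ y≈0 = y≉0 y≈0

  ≉0-resp-≈ : ∀ {u v} → ¬ v ≈ 0# → u ≈ v → ¬ u ≈ 0#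
  ≉0-resp-≈ v≉0 u≈v u≈0 = v≉0 (trans (sym u≈v) u≈0)

  *-cancelˡ : ∀ {x y z} → ¬ x ≈ 0# → x * y ≈ x * z → y ≈ z
  *-cancelˡ {x} {y} {z} x≉0 xy≈xz with *-integral {x} {y - z} x[y-z]≈0
    where
    x[y-z]≈0 : x * (y - z) ≈ 0#
    x[y-z]≈0 = trans (solve 3 (λ x y z → (x :* (y :- z)) := (x :* y :- x :* z)) refl x y z)
                     (trans (+-congʳ xy≈xz) (-‿inverseʳ _))
  ... | inj₁ x≈0   = ⊥-elim (x≉0 x≈0)
  ... | inj₂ y-z≈0 = trans (solve 2 (λ y z → y := ((y :- z) :+ z)) refl y z)
                           (trans (+-congʳ y-z≈0) (+-identityˡ z))

  natC-1 : natC 1 ≈ 1#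
  natC-1 = +-identityʳ 1#

  x*x≈1⇒x≈±1 : ∀ {x} → x * x ≈ 1# → x ≈ 1# ⊎ x ≈ - 1#
  x*x≈1⇒x≈±1 {x} xx≈1 with *-integral {x - natC 1} {x + natC 1} [x-1][x+1]≈0
    where
    [x-1][x+1]≈0 : (x - natC 1) * (x + natC 1) ≈ 0#
    [x-1][x+1]≈0 = trans (solve 1 (λ x → ((x :- con (+ 1)) :* (x :+ con (+ 1))) := (x :* x :- con (+ 1))) refl x)
                         (trans (+-congʳ (trans xx≈1 (sym natC-1))) (-‿inverseʳ _))
  ... | inj₁ x-1≈0 = inj₁ (trans (solve 1 (λ x → x := ((x :- con (+ 1)) :+ con (+ 1))) refl x)
                                 (trans (+-cong x-1≈0 natC-1) (+-identityˡ _)))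
  ... | inj₂ x+1≈0 = inj₂ (trans (solve 1 (λ x → x := ((x :+ con (+ 1)) :- con (+ 1))) refl x)
                                 (trans (+-cong x+1≈0 (-‿cong natC-1)) (+-identityˡ _)))

  -1*-1≈1 : - 1# * - 1# ≈ 1#
  -1*-1≈1 = trans (sym (-‿distribˡ-* 1# (- 1#))) (trans (-‿cong (*-identityˡ _)) (-‿involutive 1#))

  ±1*±1≈1 : ∀ {u} → u ≈ 1# ⊎ u ≈ - 1# → u * u ≈ 1#
  ±1*±1≈1 (inj₁ u≈1)  = trans (*-cong u≈1 u≈1) (*-identityˡ 1#)
  ±1*±1≈1 (inj₂ u≈-1) = trans (*-cong u≈-1 u≈-1) -1*-1≈1

  ±1≉0 : ∀ {u} → u ≈ 1# ⊎ u ≈ - 1# → ¬ u ≈ 0#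
  ±1≉0 u≈±1 u≈0 = 1≉0 (trans (sym (±1*±1≈1 u≈±1)) (trans (*-congʳ u≈0) (zeroˡ _)))

  x*-1≈-x : ∀ x → x * - 1# ≈ - x
  x*-1≈-x x = trans (sym (-‿distribʳ-* x 1#)) (-‿cong (*-identityʳ x))

  data DegView (P : Poly) : Set (c ⊔ ℓ) where
    zeroPoly : DegLt P 0 → DegView P
    hasDeg   : ∀ d l → TopCoeff P d l → ¬ l ≈ 0# → DegView P

  degView : ∀ P → DegView P
  degView []      = zeroPoly (degLt λ _ _ → refl)
  degView (a ∷ P) with degView P
  ... | hasDeg d l (sp , cp) l≉0 = hasDeg (suc d) l (degLt (λ { (suc m) (s≤s le) → vanish sp m le }) , cp) l≉0
  ... | zeroPoly sp with a ≟ 0#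
  ...   | yes a≈0 = zeroPoly (degLt λ { zero _ → a≈0 ; (suc m) _ → vanish sp m z≤n })
  ...   | no  a≉0 = hasDeg 0 a (degLt (λ { (suc m) _ → vanish sp m z≤n }) , refl) a≉0

  top-deg-unique : ∀ {P d e u v} → TopCoeff P d u → ¬ u ≈ 0# → TopCoeff P e v → ¬ v ≈ 0# → d ≡ e
  top-deg-unique {P} {d} {e} (sd , cd) u≉0 (se , ce) v≉0 with ℕP.<-cmp d e
  ... | tri< d<e _ _ = ⊥-elim (v≉0 (trans (sym ce) (vanish sd e d<e)))
  ... | tri≈ _ d≡e _ = d≡e
  ... | tri> _ _ e<d = ⊥-elim (u≉0 (trans (sym cd) (vanish se d e<d)))

  top-≉0-zeroPoly : ∀ {P d l} → DegLt P 0 → TopCoeff P d l → ¬ l ≈ 0# → ⊥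
  top-≉0-zeroPoly sp (_ , cp) l≉0 = l≉0 (trans (sym cp) (vanish sp _ z≤n))

  deg⇒top : ∀ {P d} → Deg P d → TopCoeff P d (coeff P d)
  deg⇒top (_ , above) = degLt above , refl

  top⇒deg : ∀ {P d u} → TopCoeff P d u → ¬ u ≈ 0# → Deg P d
  top⇒deg (sp , cp) u≉0 = (λ e → u≉0 (trans (sym cp) e)) , vanish sp

  deg-top-unique : ∀ {P e d v} → Deg P e → TopCoeff P d v → ¬ v ≈ 0# → e ≡ d
  deg-top-unique {P} dg tp v≉0 = top-deg-unique (deg⇒top {P} dg) (proj₁ dg) tp v≉0

  sgn-top : ∀ P {d v s} → TopCoeff P d v → ¬ v ≈ 0# → Sgn P s → v ≈ s
  sgn-top P tp v≉0 (d' , dg , cs) with deg-top-unique {P} dg tp v≉0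
  ... | ≡.refl = trans (sym (proj₂ tp)) cs

  top⇒sgn : ∀ P {d v s} → TopCoeff P d v → ¬ v ≈ 0# → v ≈ s → Sgn P s
  top⇒sgn P {d} tp v≉0 v≈s = d , top⇒deg tp v≉0 , trans (proj₂ tp) v≈s

  q^-monoʳ-< : ∀ {x y} → x ℕ.< y → q ℕ.^ x ℕ.< q ℕ.^ y
  q^-monoʳ-< = ℕP.^-monoʳ-< q 2≤q

  q^-cancelʳ-< : ∀ {x y} → q ℕ.^ x ℕ.< q ℕ.^ y → x ℕ.< y
  q^-cancelʳ-< {x} {y} lt with ℕP.<-cmp x y
  ... | tri< x<y _ _ = x<y
  ... | tri≈ _ x≡y _ = ⊥-elim (ℕP.<-irrefl (≡.cong (q ℕ.^_) x≡y) lt)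
  ... | tri> _ _ y<x = ⊥-elim (ℕP.<-asym lt (q^-monoʳ-< y<x))

  q^-cancelʳ-≤ : ∀ {x y} → q ℕ.^ x ℕ.≤ q ℕ.^ y → x ℕ.≤ y
  q^-cancelʳ-≤ {x} {y} le with ℕP.<-cmp x y
  ... | tri< x<y _ _ = ℕP.<⇒≤ x<y
  ... | tri≈ _ x≡y _ = ℕP.≤-reflexive x≡y
  ... | tri> _ _ y<x = ⊥-elim (ℕP.<⇒≱ (q^-monoʳ-< y<x) le)

  q^-injective : ∀ {x y} → q ℕ.^ x ≡ q ℕ.^ y → x ≡ y
  q^-injective eq = ℕP.≤-antisym (q^-cancelʳ-≤ (ℕP.≤-reflexive eq)) (q^-cancelʳ-≤ (ℕP.≤-reflexive (≡.sym eq)))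

  q^-positive : ∀ d → 0 ℕ.< q ℕ.^ d
  q^-positive d = ℕP.m^n>0 q {{ℕ.>-nonZero (ℕP.<-trans (s≤s z≤n) 2≤q)}} d

  abs-positive : ∀ {P m} → HasAbs P m → 0 ℕ.< m → ∃[ d ] (Deg P d × m ≡ q ℕ.^ d)
  abs-positive (inj₁ (_ , ≡.refl)) ()
  abs-positive (inj₂ abs)          _ = abs

  abs-deg : ∀ {P d m} → Deg P d → HasAbs P m → m ≡ q ℕ.^ d
  abs-deg dg (inj₁ (P≈0 , _)) = ⊥-elim (proj₁ dg (P≈0 _))
  abs-deg {P} dg (inj₂ (d' , dg' , m≡)) = ≡.trans m≡ (≡.cong (q ℕ.^_) (deg-top-unique {P} dg' (deg⇒top {P} dg) (proj₁ dg)))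

  deg⇒abs : ∀ {P d} → Deg P d → HasAbs P (q ℕ.^ d)
  deg⇒abs dg = inj₂ (_ , dg , ≡.refl)

  absLt⇒degLt : ∀ {P Q} → AbsLt P Q → ∃[ a ] (Deg Q a × DegLt P a)
  absLt⇒degLt {P} {Q} (m , n , absP , absQ , m<n) with abs-positive {Q} absQ (ℕP.≤-trans (s≤s z≤n) m<n)
  ... | a , dQ , n≡ with absP
  ...   | inj₁ (P≈0 , _)      = a , dQ , degLt-mono z≤n (degLt λ k _ → P≈0 k)
  ...   | inj₂ (b , dP , m≡) = a , dQ , degLt-mono {P} (q^-cancelʳ-< (≡.subst₂ ℕ._<_ m≡ n≡ m<n)) (degLt (proj₂ dP))

  absLe⇒degLe : ∀ {P Q a} → Deg P a → AbsLe P Q → ∃[ c' ] (Deg Q c' × a ℕ.≤ c')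
  absLe⇒degLe {P} {Q} {a} dP (m , n , absP , absQ , m≤n)
    with abs-positive {Q} absQ (ℕP.≤-trans (ℕP.≤-trans (q^-positive a) (ℕP.≤-reflexive (≡.sym (abs-deg {P} dP absP)))) m≤n)
  ... | c' , dQ , n≡ = c' , dQ , q^-cancelʳ-≤ (≡.subst₂ ℕ._≤_ (abs-deg {P} dP absP) n≡ m≤n)

  degLt-top⇒< : ∀ {P n d l} → DegLt P n → TopCoeff P d l → ¬ l ≈ 0# → d ℕ.< n
  degLt-top⇒< {n = n} {d} degP (_ , cP) l≉0 with d ℕ.<? n
  ... | yes d<n = d<n
  ... | no  d≮n = ⊥-elim (l≉0 (trans (sym cP) (vanish degP d (ℕP.≮⇒≥ d≮n))))

  degLt⇒absLt : ∀ {P Q d} → DegLt P d → Deg Q d → AbsLt P Q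
  degLt⇒absLt {P} {Q} {d} degP<d degQ with degView P
  ... | zeroPoly P≡0      = 0 , _ , inj₁ ((λ n → vanish P≡0 n z≤n) , ≡.refl) , deg⇒abs {Q} degQ , q^-positive d
  ... | hasDeg e l tP l≉0 = _ , _ , deg⇒abs {P} (top⇒deg tP l≉0) , deg⇒abs {Q} degQ , q^-monoʳ-< (degLt-top⇒< degP<d tP l≉0)

module PrimitiveRoot {c ℓ} (R : CommutativeRing c ℓ) (q : ℕ) (F : RingNotions.IsFiniteField R q)
                     (h : CommutativeRing.Carrier R) (prim : RingNotions.IsPrimitiveRoot R h) where
  open CommutativeRing R hiding (zero)
  open RingNotions R
  open IsFiniteField F
  open FiniteField R q F h public
  open import Relation.Binary.Reasoning.Setoid setoid
  open Inverse card using (to; from)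

  h≉0 : ¬ h ≈ 0#
  h≉0 = proj₁ prim

  pow-+ : ∀ x m n → pow x (m ℕ.+ n) ≈ pow x m * pow x n
  pow-+ x zero    n = sym (*-identityˡ _)
  pow-+ x (suc m) n = trans (*-congˡ (pow-+ x m n)) (sym (*-assoc _ _ _))

  pow-≉0 : ∀ {x} n → ¬ x ≈ 0# → ¬ pow x n ≈ 0#
  pow-≉0 zero    x≉0 = 1≉0
  pow-≉0 (suc n) x≉0 = *-≉0 x≉0 (pow-≉0 n x≉0)

  pow-*-≈1 : ∀ x n t → pow x n ≈ 1# → pow x (t ℕ.* n) ≈ 1#
  pow-*-≈1 x n zero    xⁿ≈1 = refl
  pow-*-≈1 x n (suc t) xⁿ≈1 =
    trans (pow-+ x n (t ℕ.* n)) (trans (*-cong xⁿ≈1 (pow-*-≈1 x n t xⁿ≈1)) (*-identityˡ _))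

  pow-% : ∀ x n k → pow x (suc n) ≈ 1# → pow x k ≈ pow x (k % suc n)
  pow-% x n k x¹⁺ⁿ≈1 = begin
    pow x k                                      ≈⟨ reflexive (≡.cong (pow x) (DM.m≡m%n+[m/n]*n k (suc n))) ⟩
    pow x (k % suc n ℕ.+ (k / suc n) ℕ.* suc n)  ≈⟨ pow-+ x (k % suc n) ((k / suc n) ℕ.* suc n) ⟩
    pow x (k % suc n) * pow x ((k / suc n) ℕ.* suc n) ≈⟨ *-congˡ (pow-*-≈1 x (suc n) (k / suc n) x¹⁺ⁿ≈1) ⟩
    pow x (k % suc n) * 1#                       ≈⟨ *-identityʳ _ ⟩
    pow x (k % suc n)                            ∎

  pow-h-cancel : ∀ i d → pow h i ≈ pow h (i ℕ.+ d) → pow h d ≈ 1#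
  pow-h-cancel i d hⁱ≈hⁱ⁺ᵈ = sym (*-cancelˡ (pow-≉0 i h≉0) (trans (*-identityʳ _) (trans hⁱ≈hⁱ⁺ᵈ (pow-+ h i d))))

  -- 0 ↦ n + 1 and h^k ↦ k mod (n + 1) is an injection F_q → {0, …, n + 1}.
  module _ (n : ℕ) (h¹⁺ⁿ≈1 : pow h (suc n) ≈ 1#) where
    private
      index : Fin q → Fin (suc (suc n))
      index i with from i ≟ 0#
      ... | yes _   = Fin.fromℕ (suc n)
      ... | no  i≉0 = Fin.inject₁ (Fin.fromℕ< (DM.m%n<n (proj₁ (proj₂ prim (from i) i≉0)) (suc n)))

      index-injective : ∀ i j → index i ≡ index j → from i ≈ from j
      index-injective i j eq with from i ≟ 0# | from j ≟ 0#
      ... | yes i≈0 | yes j≈0 = trans i≈0 (sym j≈0)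
      ... | yes _   | no  _   = ⊥-elim (FinP.toℕ-inject₁-≢ _ (≡.trans (≡.sym (FinP.toℕ-fromℕ (suc n))) (≡.cong Fin.toℕ eq)))
      ... | no  _   | yes _   = ⊥-elim (FinP.toℕ-inject₁-≢ _ (≡.trans (≡.sym (FinP.toℕ-fromℕ (suc n))) (≡.cong Fin.toℕ (≡.sym eq))))
      ... | no  i≉0 | no  j≉0 with proj₂ prim (from i) i≉0 | proj₂ prim (from j) j≉0
      ...   | k , i≈hᵏ | l , j≈hˡ = begin
          from i             ≈⟨ i≈hᵏ ⟩
          pow h k            ≈⟨ pow-% h n k h¹⁺ⁿ≈1 ⟩
          pow h (k % suc n)  ≈⟨ reflexive (≡.cong (pow h) k≡l) ⟩
          pow h (l % suc n)  ≈⟨ sym (pow-% h n l h¹⁺ⁿ≈1) ⟩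
          pow h l            ≈⟨ sym j≈hˡ ⟩
          from j             ∎
        where
        k≡l : k % suc n ≡ l % suc n
        k≡l = ≡.trans (≡.sym (FinP.toℕ-fromℕ< (DM.m%n<n k (suc n))))
                (≡.trans (≡.cong Fin.toℕ (FinP.inject₁-injective eq)) (FinP.toℕ-fromℕ< (DM.m%n<n l (suc n))))

    order-bound : q ℕ.≤ suc (suc n)
    order-bound with q ℕ.≤? suc (suc n)
    ... | yes q≤ = q≤
    ... | no  q≰ with FinP.pigeonhole (ℕP.≰⇒> q≰) index
    ...   | i , j , i<j , eq = ⊥-elim (ℕP.<-irrefl (≡.cong Fin.toℕ (from-injective (index-injective i j eq))) i<j)

  -- Pigeonhole on i ↦ h^i, which avoids 0, gives h^d ≈ 1 with 0 < d < q; the order bound forces d = q − 1.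
  module _ (n : ℕ) (q≡1+n : q ≡ suc n) where
    private
      to′ : Carrier → Fin (suc n)
      to′ x = Fin.cast q≡1+n (to x)

      to′-injective : ∀ {x y} → to′ x ≡ to′ y → x ≈ y
      to′-injective {x} {y} eq = to-injective
        (≡.trans (≡.sym (FinP.cast-involutive (≡.sym q≡1+n) q≡1+n (to x)))
        (≡.trans (≡.cong (Fin.cast (≡.sym q≡1+n)) eq) (FinP.cast-involutive (≡.sym q≡1+n) q≡1+n (to y))))

      hⁱ≢0 : (i : Fin q) → to′ 0# ≢ to′ (pow h (Fin.toℕ i))
      hⁱ≢0 i eq = pow-≉0 (Fin.toℕ i) h≉0 (sym (to′-injective eq))

      exponent : Fin q → Fin n
      exponent i = Fin.punchOut (hⁱ≢0 i)

      period≡n : ∀ d → pow h d ≈ 1# → d ≢ 0 → d ℕ.< q → d ≡ n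
      period≡n zero     _     d≢0 _   = ⊥-elim (d≢0 ≡.refl)
      period≡n (suc d′) hᵈ≈1 _   d<q = ℕP.≤-antisym (ℕP.≤-pred (≡.subst (suc d′ ℕ.<_) q≡1+n d<q))
                                                     (ℕP.≤-pred (≡.subst (ℕ._≤ suc (suc d′)) q≡1+n (order-bound d′ hᵈ≈1)))

    pow-h[q-1]≈1 : pow h n ≈ 1#
    pow-h[q-1]≈1 with FinP.pigeonhole (ℕP.≤-reflexive (≡.sym q≡1+n)) exponent
    ... | i , j , i<j , eq = trans (reflexive (≡.cong (pow h) (≡.sym d≡n))) hᵈ≈1
      where
      d = Fin.toℕ j ℕ.∸ Fin.toℕ i
      j≡i+d : Fin.toℕ j ≡ Fin.toℕ i ℕ.+ d
      j≡i+d = ≡.sym (ℕP.m+[n∸m]≡n (ℕP.<⇒≤ i<j))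
      hᵈ≈1 : pow h d ≈ 1#
      hᵈ≈1 = pow-h-cancel (Fin.toℕ i) d (trans (to′-injective (FinP.punchOut-injective (hⁱ≢0 i) (hⁱ≢0 j) eq))
                                              (reflexive (≡.cong (pow h) j≡i+d)))
      d≢0 : d ≢ 0
      d≢0 d≡0 = ℕP.<-irrefl (≡.sym (≡.trans j≡i+d (≡.trans (≡.cong (Fin.toℕ i ℕ.+_) d≡0) (ℕP.+-identityʳ _)))) i<j
      d≡n : d ≡ n
      d≡n = period≡n d hᵈ≈1 d≢0 (ℕP.≤-<-trans (ℕP.m∸n≤m (Fin.toℕ j) (Fin.toℕ i)) (FinP.toℕ<n j))

  module Characteristic (p k : ℕ) (p-prime : Prime p) (5≤p : 5 ℕ.≤ p) (q≡pᵏ : q ≡ p ℕ.^ k) (char-p : HasChar p) where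
    open Forms R _⁻¹ q h using (InS)

    2∤1 : ¬ 2 ∣ 1
    2∤1 2∣1 with ∣1⇒≡1 2∣1
    ... | ()

    2∤p : ¬ 2 ∣ p
    2∤p 2∣p with prime⇒irreducible p-prime 2∣p
    ... | inj₁ ()
    ... | inj₂ 2≡p = ℕP.<-irrefl 2≡p (ℕP.≤-trans (s≤s (s≤s (s≤s z≤n))) 5≤p)

    2∤q : ¬ 2 ∣ q
    2∤q 2∣q = 2∤pᵏ k (≡.subst (2 ∣_) q≡pᵏ 2∣q)
      where
      2∤pᵏ : ∀ k → ¬ 2 ∣ p ℕ.^ k
      2∤pᵏ zero    = 2∤1
      2∤pᵏ (suc k) 2∣p·pᵏ with euclidsLemma p (p ℕ.^ k) prime[2] 2∣p·pᵏ
      ... | inj₁ 2∣p  = 2∤p 2∣p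
      ... | inj₂ 2∣pᵏ = 2∤pᵏ k 2∣pᵏ

    odd≡1+[n/2]*2 : ∀ n → ¬ 2 ∣ n → n ≡ 1 ℕ.+ (n / 2) ℕ.* 2
    odd≡1+[n/2]*2 n 2∤n with n % 2 | DM.m≡m%n+[m/n]*n n 2 | DM.m%n<n n 2 | 2∣-if-%≡0
      where
      2∣-if-%≡0 : n % 2 ≡ 0 → 2 ∣ n
      2∣-if-%≡0 = m%n≡0⇒n∣m n 2
    ... | zero          | _  | _                 | 2∣n = ⊥-elim (2∤n (2∣n ≡.refl))
    ... | suc zero      | eq | _                 | _   = eq
    ... | suc (suc _)   | _  | s≤s (s≤s ())      | _

    2≉0 : ¬ natC 2 ≈ 0#
    2≉0 2≈0 = 1≉0 (begin
      1#                                   ≈⟨ sym natC-1 ⟩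
      natC 1                               ≈⟨ sym (+-identityʳ _) ⟩
      natC 1 + 0#                          ≈⟨ +-congˡ (sym (trans (*-congˡ 2≈0) (zeroʳ _))) ⟩
      natC 1 + natC (p / 2) * natC 2       ≈⟨ +-congˡ (sym (natC-*-homo (p / 2) 2)) ⟩
      natC 1 + natC (p / 2 ℕ.* 2)          ≈⟨ sym (natC-+-homo 1 (p / 2 ℕ.* 2)) ⟩
      natC (1 ℕ.+ p / 2 ℕ.* 2)             ≈⟨ reflexive (≡.cong natC (≡.sym (odd≡1+[n/2]*2 p 2∤p))) ⟩
      natC p                               ≈⟨ char-p ⟩
      0#                                   ∎)

    4≉0 : ¬ natC 4 ≈ 0#
    4≉0 4≈0 = *-≉0 2≉0 2≉0 (trans (sym (natC-*-homo 2 2)) 4≈0)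

    n+n≡n*2 : ∀ n → n ℕ.+ n ≡ n ℕ.* 2
    n+n≡n*2 = solve-∀

    n₂ : ℕ
    n₂ = q ℕ.∸ 2

    q≡2+n₂ : q ≡ suc (suc n₂)
    q≡2+n₂ = ≡.sym (ℕP.m+[n∸m]≡n 2≤q)

    2∣q-1 : 2 ∣ suc n₂
    2∣q-1 = divides (q / 2) (ℕP.suc-injective (≡.trans (≡.sym q≡2+n₂) (odd≡1+[n/2]*2 q 2∤q)))

    order-∣ : ∀ m → pow h m ≈ 1# → suc n₂ ∣ m
    order-∣ m hᵐ≈1 = m%n≡0⇒n∣m m (suc n₂)
      (remainder≡0 (m % suc n₂) (DM.m%n<n m (suc n₂)) (trans (sym (pow-% h n₂ m (pow-h[q-1]≈1 (suc n₂) q≡2+n₂))) hᵐ≈1))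
      where
      remainder≡0 : ∀ r → r ℕ.< suc n₂ → pow h r ≈ 1# → r ≡ 0
      remainder≡0 zero    _   _     = ≡.refl
      remainder≡0 (suc r) r<q-1 hʳ≈1 =
        ⊥-elim (ℕP.<⇒≱ (ℕP.≤-reflexive (≡.sym q≡2+n₂)) (ℕP.≤-trans (order-bound r hʳ≈1) r<q-1))

    -- h^(2k) ≈ h would give q − 1 ∣ 2k + q − 2, which is odd.
    h-nonsquare : ¬ IsSquare h
    h-nonsquare (y , y*y≈h) with y ≟ 0#
    ... | yes y≈0 = h≉0 (trans (sym y*y≈h) (trans (*-congʳ y≈0) (zeroˡ y)))
    ... | no  y≉0 with proj₂ prim y y≉0
    ...   | k , y≈hᵏ = 2∤1 (∣m+n∣m⇒∣n (≡.subst (2 ∣_) (ℕP.+-comm 1 n₂) 2∣q-1) 2∣n₂)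
      where
      h^[k+k+n₂]≈1 : pow h (k ℕ.+ k ℕ.+ n₂) ≈ 1#
      h^[k+k+n₂]≈1 = begin
        pow h (k ℕ.+ k ℕ.+ n₂)            ≈⟨ pow-+ h (k ℕ.+ k) n₂ ⟩
        pow h (k ℕ.+ k) * pow h n₂         ≈⟨ *-congʳ (pow-+ h k k) ⟩
        (pow h k * pow h k) * pow h n₂     ≈⟨ *-congʳ (*-cong (sym y≈hᵏ) (sym y≈hᵏ)) ⟩
        (y * y) * pow h n₂                 ≈⟨ *-congʳ y*y≈h ⟩
        pow h (suc n₂)                     ≈⟨ pow-h[q-1]≈1 (suc n₂) q≡2+n₂ ⟩
        1#                                 ∎
      2∣n₂ : 2 ∣ n₂
      2∣n₂ = ∣m+n∣m⇒∣n (∣-trans 2∣q-1 (order-∣ _ h^[k+k+n₂]≈1)) (divides k (n+n≡n*2 k))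

    pow-h≉-1 : ∀ m → pow h m ≈ - 1# → m ℕ.≤ (q ℕ.∸ 3) / 2 → ⊥
    pow-h≉-1 zero    1≈-1 _ = 2≉0 (begin
      natC 2      ≈⟨ +-congˡ natC-1 ⟩
      1# + 1#     ≈⟨ +-congˡ 1≈-1 ⟩
      1# + - 1#   ≈⟨ -‿inverseʳ 1# ⟩
      0#          ∎)
    pow-h≉-1 (suc m) hᵐ≈-1 m≤ = ℕP.<⇒≱ (s≤s (ℕP.m∸n≤m n₂ 1))
      (ℕP.≤-trans (∣⇒≤ (order-∣ (suc m ℕ.+ suc m) h^[m+m]≈1))
      (ℕP.≤-trans (ℕP.≤-reflexive (n+n≡n*2 (suc m)))
      (ℕP.≤-trans (ℕP.*-monoˡ-≤ 2 m≤)
      (ℕP.≤-trans (DM.m/n*n≤m (q ℕ.∸ 3) 2) (ℕP.≤-reflexive (≡.cong (ℕ._∸ 3) q≡2+n₂))))))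
      where
      h^[m+m]≈1 : pow h (suc m ℕ.+ suc m) ≈ 1#
      h^[m+m]≈1 = trans (pow-+ h (suc m) (suc m)) (trans (*-cong hᵐ≈-1 hᵐ≈-1) -1*-1≈1)

    quotient-≈-1 : ∀ i m x → x ≈ pow h i → - x ≈ pow h (i ℕ.+ m) → pow h m ≈ - 1#
    quotient-≈-1 i m x x≈hⁱ -x≈hⁱ⁺ᵐ = *-cancelˡ (pow-≉0 i h≉0) (begin
      pow h i * pow h m   ≈⟨ sym (pow-+ h i m) ⟩
      pow h (i ℕ.+ m)     ≈⟨ sym -x≈hⁱ⁺ᵐ ⟩
      - x                 ≈⟨ -‿cong x≈hⁱ ⟩
      - pow h i           ≈⟨ sym (x*-1≈-x _) ⟩
      pow h i * - 1#      ∎)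

    ¬InS-both : ∀ x → InS x → InS (- x) → ⊥
    ¬InS-both x (i , i≤ , x≈hⁱ) (j , j≤ , -x≈hʲ) with ℕP.≤-total i j
    ... | inj₁ i≤j = pow-h≉-1 (j ℕ.∸ i)
      (quotient-≈-1 i (j ℕ.∸ i) x x≈hⁱ (trans -x≈hʲ (reflexive (≡.cong (pow h) (≡.sym (ℕP.m+[n∸m]≡n i≤j))))))
      (ℕP.≤-trans (ℕP.m∸n≤m j i) j≤)
    ... | inj₂ j≤i = pow-h≉-1 (i ℕ.∸ j)
      (quotient-≈-1 j (i ℕ.∸ j) (- x) -x≈hʲ
        (trans (-‿involutive x) (trans x≈hⁱ (reflexive (≡.cong (pow h) (≡.sym (ℕP.m+[n∸m]≡n j≤i)))))))
      (ℕP.≤-trans (ℕP.m∸n≤m i j) i≤)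

module ReducedForms {c ℓ} (R : CommutativeRing c ℓ) (p k q : ℕ) (p-prime : Prime p) (5≤p : 5 ℕ.≤ p)
                    (q≡pᵏ : q ≡ p ℕ.^ k) (F : RingNotions.IsFiniteField R q) (char-p : RingNotions.HasChar R p)
                    (h : CommutativeRing.Carrier R) (prim : RingNotions.IsPrimitiveRoot R h) where
  open CommutativeRing R hiding (zero)
  open RingNotions R
  open IsFiniteField F
  open Forms R _⁻¹ q h
  open PrimitiveRoot R q F h prim
  open Characteristic p k p-prime 5≤p q≡pᵏ char-p
  open DegreeArithmetic
  open import Relation.Binary.Reasoning.Setoid setoid
  open import Algebra.Properties.Ring ring using (-0#≈0#)

  top-Disc : ∀ f {a c sA sC} → TopCoeff (A f) a sA → TopCoeff (C f) c sC → DegLt (B f) a → a ≤ c →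
             TopCoeff (Disc f) (a ℕ.+ c) (- (natC 4 * sA * sC))
  top-Disc f {a} topA topC degB<a a≤c = top-≈ (+-identityˡ _)
    (top-+ (degLt⇒top (degLt-*-diag (B f) (B f) a degB<a degB<a) (ℕP.+-monoʳ-≤ a a≤c))
           (top-neg (top-* (top-* (top-const (natC 4)) topA) topC)))

  -4sAsC≉0 : ∀ {sA sC} → ¬ sA ≈ 0# → ¬ sC ≈ 0# → ¬ - (natC 4 * sA * sC) ≈ 0#
  -4sAsC≉0 sA≉0 sC≉0 eq = *-≉0 (*-≉0 4≉0 sA≉0) sC≉0 (trans (sym (-‿involutive _)) (trans (-‿cong eq) -0#≈0#))

  -- (2 sA u / v)² = −4 sA sC
  isotropic⇒square : ∀ sA sC u v → ¬ v ≈ 0# → sA * u * u + sC * v * v ≈ 0# → IsSquare (- (natC 4 * sA * sC))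
  isotropic⇒square sA sC u v v≉0 isotropic = w , (begin
      w * w                                      ≈⟨ solve 3 (λ sA u v⁻¹ → ((con (+ 2) :* sA) :* u :* v⁻¹) :* ((con (+ 2) :* sA) :* u :* v⁻¹)
                                                                := (con (+ 4) :* sA :* v⁻¹ :* v⁻¹) :* (sA :* u :* u)) refl sA u v⁻¹ ⟩
      (natC 4 * sA * v⁻¹ * v⁻¹) * (sA * u * u)   ≈⟨ *-congˡ sAuu≈-sCvv ⟩
      (natC 4 * sA * v⁻¹ * v⁻¹) * - (sC * v * v) ≈⟨ solve 4 (λ sA sC v v⁻¹ → (con (+ 4) :* sA :* v⁻¹ :* v⁻¹) :* (:- (sC :* v :* v))
                                                                := (:- (con (+ 4) :* sA :* sC)) :* (v :* v⁻¹) :* (v :* v⁻¹)) refl sA sC v v⁻¹ ⟩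
      - (natC 4 * sA * sC) * (v * v⁻¹) * (v * v⁻¹) ≈⟨ *-cong (*-congˡ (inverse v v≉0)) (inverse v v≉0) ⟩
      - (natC 4 * sA * sC) * 1# * 1#             ≈⟨ trans (*-identityʳ _) (*-identityʳ _) ⟩
      - (natC 4 * sA * sC)                       ∎)
    where
    v⁻¹ = v ⁻¹
    w = natC 2 * sA * u * v⁻¹
    sAuu≈-sCvv : sA * u * u ≈ - (sC * v * v)
    sAuu≈-sCvv = trans (solve 2 (λ X Y → X := ((X :+ Y) :- Y)) refl _ _) (trans (+-congʳ isotropic) (+-identityˡ _))

  -- The top-degree terms of A x² and C y² never cancel.
  record Profile (f : Form) : Set (c ⊔ ℓ) where
    field
      da dc       : ℕ
      sA sC       : Carrier
      topA        : TopCoeff (A f) da sA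
      sA≉0        : ¬ sA ≈ 0#
      topC        : TopCoeff (C f) dc sC
      sC≉0        : ¬ sC ≈ 0#
      da≤dc       : da ≤ dc
      degB<da     : DegLt (B f) da
      anisotropic : ∀ dx dy u v → da ℕ.+ dx ℕ.+ dx ≡ dc ℕ.+ dy ℕ.+ dy → ¬ u ≈ 0# → ¬ v ≈ 0# →
                    ¬ (sA * u * u + sC * v * v ≈ 0#)

    topDisc : TopCoeff (Disc f) (da ℕ.+ dc) (- (natC 4 * sA * sC))
    topDisc = top-Disc f topA topC degB<da da≤dc

    degDisc≡ : ∀ {d} → Deg (Disc f) d → d ≡ da ℕ.+ dc
    degDisc≡ dg = deg-top-unique {Disc f} dg topDisc (-4sAsC≉0 sA≉0 sC≉0)

  -- Cancellation would need deg A + deg C even (imaginary case) or sgn D a square (unusual case).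
  anisotropic-if-imaginary-or-unusual :
    ∀ f {a c sA sC} → TopCoeff (A f) a sA → TopCoeff (C f) c sC → DegLt (B f) a → a ≤ c →
    ¬ sA ≈ 0# → ¬ sC ≈ 0# → Imaginary f ⊎ Unusual f →
    ∀ dx dy u v → a ℕ.+ dx ℕ.+ dx ≡ c ℕ.+ dy ℕ.+ dy → ¬ u ≈ 0# → ¬ v ≈ 0# → ¬ (sA * u * u + sC * v * v ≈ 0#)
  anisotropic-if-imaginary-or-unusual f {a} {c} topA topC degB<a a≤c sA≉0 sC≉0 kind dx dy u v balanced _ v≉0 isotropic
    with kind
  ... | inj₁ (d , dg , k , d≡odd) = balanced⇒sum-even a c dx dy k balanced (≡.trans (≡.sym d≡a+c) d≡odd)
    where
    d≡a+c = deg-top-unique {Disc f} dg (top-Disc f topA topC degB<a a≤c) (-4sAsC≉0 sA≉0 sC≉0)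
  ... | inj₂ (d , dg , _ , _ , sgnD-nonsquare) with isotropic⇒square _ _ u v v≉0 isotropic
  ...   | w , w*w≈ = sgnD-nonsquare (w , trans w*w≈ (top-unique (top-subst (≡.sym d≡a+c) topD) (deg⇒top {Disc f} dg)))
    where
    topD = top-Disc f topA topC degB<a a≤c
    d≡a+c = deg-top-unique {Disc f} dg topD (-4sAsC≉0 sA≉0 sC≉0)

  profile : ∀ f → Standing f → PartiallyReduced f → Profile f
  profile f (_ , _ , _ , _ , _ , kind) (|B|<|A| , |A|≤|C| , _) with absLt⇒degLt {B f} {A f} |B|<|A|
  ... | a , degA , degB<a with absLe⇒degLe {A f} {C f} degA |A|≤|C|
  ...   | c , degC , a≤c = record
      { da = a ; dc = c ; sA = coeff (A f) a ; sC = coeff (C f) c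
      ; topA = deg⇒top {A f} degA ; sA≉0 = proj₁ degA ; topC = deg⇒top {C f} degC ; sC≉0 = proj₁ degC
      ; da≤dc = a≤c ; degB<da = degB<a
      ; anisotropic = anisotropic-if-imaginary-or-unusual f (deg⇒top {A f} degA) (deg⇒top {C f} degC) degB<a a≤c
                        (proj₁ degA) (proj₁ degC) kind }

  value : Form → Poly → Poly → Poly
  value f x y = A f *ₚ x *ₚ x +ₚ B f *ₚ x *ₚ y +ₚ C f *ₚ y *ₚ y

  bound-by-deg : ∀ {P d l} (g : ℕ → ℕ) → TopCoeff P d l → ¬ l ≈ 0# → ∀ {e} → g d ≤ e →
                 ∀ {d′ l′} → TopCoeff P d′ l′ → ¬ l′ ≈ 0# → g d′ ≤ e
  bound-by-deg g tp l≉0 gd≤e tp′ l′≉0 = ≡.subst (λ d → g d ≤ _) (top-deg-unique tp l≉0 tp′ l′≉0) gd≤e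

  module Values {f : Form} (pf : Profile f) where
    open Profile pf

    top-Axx : ∀ {x dx lx} → TopCoeff x dx lx → TopCoeff (A f *ₚ x *ₚ x) (da ℕ.+ dx ℕ.+ dx) (sA * lx * lx)
    top-Axx tx = top-* (top-* topA tx) tx

    top-Cyy : ∀ {y dy ly} → TopCoeff y dy ly → TopCoeff (C f *ₚ y *ₚ y) (dc ℕ.+ dy ℕ.+ dy) (sC * ly * ly)
    top-Cyy ty = top-* (top-* topC ty) ty

    degLt-Bxy : ∀ {x y dx dy lx ly} → TopCoeff x dx lx → TopCoeff y dy ly → DegLt (B f *ₚ x *ₚ y) (da ℕ.+ dx ℕ.+ dy)
    degLt-Bxy {x} {y} {dx} {dy} (degx , _) (degy , _) =
      degLt-* (B f *ₚ x) y (da ℕ.+ dx) dy (degLt-* (B f) x da dx degB<da degx) degy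

    top-value : ∀ {x y N u v w} → TopCoeff (A f *ₚ x *ₚ x) N u → TopCoeff (B f *ₚ x *ₚ y) N v →
                TopCoeff (C f *ₚ y *ₚ y) N w → TopCoeff (value f x y) N (u + v + w)
    top-value tAxx tBxy tCyy = top-+ (top-+ tAxx tBxy) tCyy

    top-value-balanced : ∀ {x y dx dy lx ly N} → TopCoeff x dx lx → TopCoeff y dy ly →
                         da ℕ.+ dx ℕ.+ dx ≡ N → dc ℕ.+ dy ℕ.+ dy ≡ N →
                         TopCoeff (value f x y) N (sA * lx * lx + sC * ly * ly)
    top-value-balanced tx ty ≡N ≡N′ = top-≈ (+-congʳ (+-identityʳ _)) (top-value
      (top-subst ≡N (top-Axx tx))
      (degLt⇒top (degLt-Bxy tx ty) (cross-term-bound da≤dc (ℕP.≤-reflexive ≡N) (ℕP.≤-reflexive ≡N′)))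
      (top-subst ≡N′ (top-Cyy ty)))

    record ValueDegree (x y : Poly) (e : ℕ) : Set (c ⊔ ℓ) where
      field
        degree  : Deg (value f x y) e
        x-bound : ∀ {dx lx} → TopCoeff x dx lx → ¬ lx ≈ 0# → da ℕ.+ dx ℕ.+ dx ≤ e
        y-bound : ∀ {dy ly} → TopCoeff y dy ly → ¬ ly ≈ 0# → dc ℕ.+ dy ℕ.+ dy ≤ e

    value-degree : ∀ x y → ¬ (DegLt x 0 × DegLt y 0) → ∃[ e ] ValueDegree x y e
    value-degree x y x,y≢0 with degView x | degView y
    ... | zeroPoly x≡0 | zeroPoly y≡0 = ⊥-elim (x,y≢0 (x≡0 , y≡0))
    ... | hasDeg dx lx tx lx≉0 | zeroPoly y≡0 = _ , record
        { degree  = top⇒deg (top-value (top-Axx tx) (degLt⇒top (zero-*ₚʳ (B f *ₚ x) y y≡0) z≤n)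
                                       (degLt⇒top (zero-*ₚˡ (C f *ₚ y) y (zero-*ₚʳ (C f) y y≡0)) z≤n))
                            (≉0-resp-≈ (*-≉0 (*-≉0 sA≉0 lx≉0) lx≉0) (trans (+-congʳ (+-identityʳ _)) (+-identityʳ _)))
        ; x-bound = bound-by-deg (λ d → da ℕ.+ d ℕ.+ d) tx lx≉0 ℕP.≤-refl
        ; y-bound = λ ty ly≉0 → ⊥-elim (top-≉0-zeroPoly y≡0 ty ly≉0) }
    ... | zeroPoly x≡0 | hasDeg dy ly ty ly≉0 = _ , record
        { degree  = top⇒deg (top-value (degLt⇒top (zero-*ₚˡ (A f *ₚ x) x (zero-*ₚʳ (A f) x x≡0)) z≤n)
                                       (degLt⇒top (zero-*ₚˡ (B f *ₚ x) y (zero-*ₚʳ (B f) x x≡0)) z≤n) (top-Cyy ty))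
                            (≉0-resp-≈ (*-≉0 (*-≉0 sC≉0 ly≉0) ly≉0) (trans (+-congʳ (+-identityʳ _)) (+-identityˡ _)))
        ; x-bound = λ tx lx≉0 → ⊥-elim (top-≉0-zeroPoly x≡0 tx lx≉0)
        ; y-bound = bound-by-deg (λ d → dc ℕ.+ d ℕ.+ d) ty ly≉0 ℕP.≤-refl }
    ... | hasDeg dx lx tx lx≉0 | hasDeg dy ly ty ly≉0 with ℕP.<-cmp (da ℕ.+ dx ℕ.+ dx) (dc ℕ.+ dy ℕ.+ dy)
    ...   | tri< ax<cy _ _ = _ , record
        { degree  = top⇒deg (top-value (top-raise (top-Axx tx) ax<cy)
                                       (degLt⇒top (degLt-Bxy tx ty) (cross-term-bound da≤dc (ℕP.<⇒≤ ax<cy) ℕP.≤-refl))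
                                       (top-Cyy ty))
                            (≉0-resp-≈ (*-≉0 (*-≉0 sC≉0 ly≉0) ly≉0) (trans (+-congʳ (+-identityʳ _)) (+-identityˡ _)))
        ; x-bound = bound-by-deg (λ d → da ℕ.+ d ℕ.+ d) tx lx≉0 (ℕP.<⇒≤ ax<cy)
        ; y-bound = bound-by-deg (λ d → dc ℕ.+ d ℕ.+ d) ty ly≉0 ℕP.≤-refl }
    ...   | tri> _ _ cy<ax = _ , record
        { degree  = top⇒deg (top-value (top-Axx tx)
                                       (degLt⇒top (degLt-Bxy tx ty) (cross-term-bound da≤dc ℕP.≤-refl (ℕP.<⇒≤ cy<ax)))
                                       (top-raise (top-Cyy ty) cy<ax))
                            (≉0-resp-≈ (*-≉0 (*-≉0 sA≉0 lx≉0) lx≉0) (trans (+-congʳ (+-identityʳ _)) (+-identityʳ _)))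
        ; x-bound = bound-by-deg (λ d → da ℕ.+ d ℕ.+ d) tx lx≉0 ℕP.≤-refl
        ; y-bound = bound-by-deg (λ d → dc ℕ.+ d ℕ.+ d) ty ly≉0 (ℕP.<⇒≤ cy<ax) }
    ...   | tri≈ _ ax≡cy _ = _ , record
        { degree  = top⇒deg (top-value-balanced tx ty ≡.refl (≡.sym ax≡cy)) (anisotropic dx dy lx ly ax≡cy lx≉0 ly≉0)
        ; x-bound = bound-by-deg (λ d → da ℕ.+ d ℕ.+ d) tx lx≉0 ℕP.≤-refl
        ; y-bound = bound-by-deg (λ d → dc ℕ.+ d ℕ.+ d) ty ly≉0 (ℕP.≤-reflexive (≡.sym ax≡cy)) }

    module ConstantAction {M : Mat} {a b g d : Carrier} (tα : TopCoeff (α M) 0 a) (tβ : TopCoeff (β M) 0 b)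
                          (tγ : TopCoeff (γ M) 0 g) (tδ : TopCoeff (δ M) 0 d) (da≡dc : da ≡ dc) where
      private
        da+0+0≡da : da ℕ.+ 0 ℕ.+ 0 ≡ da
        da+0+0≡da = ≡.trans (ℕP.+-identityʳ _) (ℕP.+-identityʳ da)
        dc+0+0≡da : dc ℕ.+ 0 ℕ.+ 0 ≡ da
        dc+0+0≡da = ≡.trans (ℕP.+-identityʳ _) (≡.trans (ℕP.+-identityʳ dc) (≡.sym da≡dc))

      top-A∘M : TopCoeff (A (f ∘F M)) da (sA * a * a + sC * g * g)
      top-A∘M = top-value-balanced tα tγ da+0+0≡da dc+0+0≡da

      top-C∘M : TopCoeff (C (f ∘F M)) da (sA * b * b + sC * d * d)
      top-C∘M = top-value-balanced tβ tδ da+0+0≡da dc+0+0≡da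

      top-B∘M : TopCoeff (B (f ∘F M)) da (natC 2 * sA * a * b + natC 2 * sC * g * d)
      top-B∘M = top-≈ (+-congʳ (+-identityʳ _)) (top-+ (top-+
        (top-subst da+0+0≡da (top-* (top-* (top-* (top-const (natC 2)) topA) tα) tβ))
        (degLt⇒top (degLt-* (B f) (α M *ₚ δ M +ₚ β M *ₚ γ M) da 0 degB<da
                      (degLt-+ (proj₁ (top-* tα tδ)) (proj₁ (top-* tβ tγ))))
                   (ℕP.≤-reflexive (ℕP.+-identityʳ da))))
        (top-subst dc+0+0≡da (top-* (top-* (top-* (top-const (natC 2)) topC) tγ) tδ)))


  Constant : Poly → Set (c ⊔ ℓ)
  Constant P = ∃[ l ] TopCoeff P 0 l

  constant-if-bounded : ∀ x base → (∀ {d l} → TopCoeff x d l → ¬ l ≈ 0# → base ℕ.+ d ℕ.+ d ≤ base) → Constant x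
  constant-if-bounded x base bound with degView x
  ... | zeroPoly x≡0          = 0# , degLt⇒top x≡0 z≤n
  ... | hasDeg d l tx l≉0     = l , top-subst (a+x+x≤a⇒x≡0 base d (bound tx l≉0)) tx

  module SameDiscriminant {f f′ : Form} (pf : Profile f) (pf′ : Profile f′) (sameDisc : Disc f ≈ₚ Disc f′) where
    private
      module Pf  = Profile pf
      module Pf′ = Profile pf′

    degree-sum≡ : Pf.da ℕ.+ Pf.dc ≡ Pf′.da ℕ.+ Pf′.dc
    degree-sum≡ = top-deg-unique (top-≈ₚ sameDisc Pf.topDisc) (-4sAsC≉0 Pf.sA≉0 Pf.sC≉0)
                                 Pf′.topDisc (-4sAsC≉0 Pf′.sA≉0 Pf′.sC≉0)

    4sAsC≈4sA′sC′ : natC 4 * Pf.sA * Pf.sC ≈ natC 4 * Pf′.sA * Pf′.sC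
    4sAsC≈4sA′sC′ = -‿injective (top-unique (top-≈ₚ sameDisc Pf.topDisc) (top-subst (≡.sym degree-sum≡) Pf′.topDisc))
      where
      -‿injective : ∀ {x y} → - x ≈ - y → x ≈ y
      -‿injective {x} {y} -x≈-y = trans (sym (-‿involutive x)) (trans (-‿cong -x≈-y) (-‿involutive y))

  module Transformation {f f′ : Form} (pf : Profile f) (pf′ : Profile f′) (sameDisc : Disc f ≈ₚ Disc f′)
                        (M : Mat) (M∈GL₂ : InGL2 M) (f′≈fM : f′ ≈F f ∘F M) where
    private
      module Pf  = Profile pf
      module Pf′ = Profile pf′
    open Values pf

    open SameDiscriminant pf pf′ sameDisc using () renaming (degree-sum≡ to sum≡)

    top-A′ : TopCoeff (value f (α M) (γ M)) Pf′.da Pf′.sA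
    top-A′ = top-≈ₚ (proj₁ f′≈fM) Pf′.topA

    top-C′ : TopCoeff (value f (β M) (δ M)) Pf′.dc Pf′.sC
    top-C′ = top-≈ₚ (proj₂ (proj₂ f′≈fM)) Pf′.topC

    private
      det≢0 : DegLt (α M *ₚ δ M) 0 → DegLt (β M *ₚ γ M) 0 → ⊥
      det≢0 αδ≡0 βγ≡0 = proj₁ (proj₂ M∈GL₂)
        (trans (sym (proj₂ (proj₂ M∈GL₂) 0)) (vanish (degLt-+ αδ≡0 (degLt-neg βγ≡0)) 0 z≤n))

      first-column≢0 : ¬ (DegLt (α M) 0 × DegLt (γ M) 0)
      first-column≢0 (α≡0 , γ≡0) = det≢0 (zero-*ₚˡ (α M) (δ M) α≡0) (zero-*ₚʳ (β M) (γ M) γ≡0)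

      second-column≢0 : ¬ (DegLt (β M) 0 × DegLt (δ M) 0)
      second-column≢0 (β≡0 , δ≡0) = det≢0 (zero-*ₚʳ (α M) (δ M) δ≡0) (zero-*ₚˡ (β M) (γ M) β≡0)

      first-column = value-degree (α M) (γ M) first-column≢0
      module Col₁ = ValueDegree (proj₂ first-column)
      e₁≡ : proj₁ first-column ≡ Pf′.da
      e₁≡ = deg-top-unique {value f (α M) (γ M)} Col₁.degree top-A′ Pf′.sA≉0

      second-column = value-degree (β M) (δ M) second-column≢0
      module Col₂ = ValueDegree (proj₂ second-column)
      e₂≡ : proj₁ second-column ≡ Pf′.dc
      e₂≡ = deg-top-unique {value f (β M) (δ M)} Col₂.degree top-C′ Pf′.sC≉0

    -- γ ≠ 0 forces deg A = deg C and a constant M; otherwise M is upper triangular with constant diagonal.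
    data Shape : Set (c ⊔ ℓ) where
      balanced : Pf.da ≡ Pf.dc → Pf′.da ≡ Pf.da → Pf′.dc ≡ Pf.dc →
                 Constant (α M) → Constant (β M) → Constant (γ M) → Constant (δ M) → Shape
      upper-triangular : DegLt (γ M) 0 → Pf′.da ≡ Pf.da → Pf′.dc ≡ Pf.dc →
                         (∃[ l ] (TopCoeff (α M) 0 l × ¬ l ≈ 0#)) → (∃[ l ] (TopCoeff (δ M) 0 l × ¬ l ≈ 0#)) →
                         (DegLt (β M) 0 ⊎ ∃[ d ] ∃[ l ] (TopCoeff (β M) d l × ¬ l ≈ 0# × Pf.da ℕ.+ d ℕ.+ d ≤ Pf.dc)) → Shape

    shape : Shape
    shape with degView (γ M)
    ... | hasDeg dγ lγ tγ lγ≉0 with squeezed-bounds Pf.da Pf.dc Pf′.da Pf′.dc dγ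
                                     (ℕP.≤-trans (Col₁.y-bound tγ lγ≉0) (ℕP.≤-reflexive e₁≡)) Pf′.da≤dc sum≡ Pf.da≤dc
    ...   | dγ≡0 , a′≡c , a≡c , c′≡c = balanced a≡c (≡.trans a′≡c (≡.sym a≡c)) c′≡c
          (constant-if-bounded (α M) Pf.da λ tα lα≉0 →
            ℕP.≤-trans (Col₁.x-bound tα lα≉0) (ℕP.≤-reflexive (≡.trans e₁≡ (≡.trans a′≡c (≡.sym a≡c)))))
          (constant-if-bounded (β M) Pf.da λ tβ lβ≉0 →
            ℕP.≤-trans (Col₂.x-bound tβ lβ≉0) (ℕP.≤-reflexive (≡.trans e₂≡ (≡.trans c′≡c (≡.sym a≡c)))))
          (lγ , top-subst dγ≡0 tγ)
          (constant-if-bounded (δ M) Pf.dc λ tδ lδ≉0 →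
            ℕP.≤-trans (Col₂.y-bound tδ lδ≉0) (ℕP.≤-reflexive (≡.trans e₂≡ c′≡c)))
    shape | zeroPoly γ≡0 with degView (α M) | degView (δ M)
    ... | zeroPoly α≡0 | _ = ⊥-elim (first-column≢0 (α≡0 , γ≡0))
    ... | hasDeg _ _ _ _ | zeroPoly δ≡0 = ⊥-elim (det≢0 (zero-*ₚʳ (α M) (δ M) δ≡0) (zero-*ₚʳ (β M) (γ M) γ≡0))
    ... | hasDeg dα lα tα lα≉0 | hasDeg dδ lδ tδ lδ≉0
      with tight-bounds Pf.da Pf.dc Pf′.da Pf′.dc dα dδ (ℕP.≤-trans (Col₁.x-bound tα lα≉0) (ℕP.≤-reflexive e₁≡))
                                                         (ℕP.≤-trans (Col₂.y-bound tδ lδ≉0) (ℕP.≤-reflexive e₂≡)) sum≡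
    ...   | dα≡0 , dδ≡0 , a′≡a , c′≡c =
      upper-triangular γ≡0 a′≡a c′≡c (lα , top-subst dα≡0 tα , lα≉0) (lδ , top-subst dδ≡0 tδ , lδ≉0) β-bound
      where
      β-bound : DegLt (β M) 0 ⊎ ∃[ d ] ∃[ l ] (TopCoeff (β M) d l × ¬ l ≈ 0# × Pf.da ℕ.+ d ℕ.+ d ≤ Pf.dc)
      β-bound with degView (β M)
      ... | zeroPoly β≡0       = inj₁ β≡0
      ... | hasDeg d l tβ l≉0 = inj₂ (d , l , tβ , l≉0 , ℕP.≤-trans (Col₂.x-bound tβ l≉0) (ℕP.≤-reflexive (≡.trans e₂≡ c′≡c)))

    constant-entries : Pf.da ≡ Pf.dc → Shape → Constant (α M) × Constant (β M) × Constant (γ M) × Constant (δ M)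
    constant-entries _     (balanced _ _ _ cα cβ cγ cδ) = cα , cβ , cγ , cδ
    constant-entries da≡dc (upper-triangular γ≡0 _ _ (a , tα , _) (d , tδ , _) β-bound) =
      (a , tα) , β-constant β-bound , (0# , degLt⇒top γ≡0 z≤n) , (d , tδ)
      where
      β-constant : DegLt (β M) 0 ⊎ ∃[ d ] ∃[ l ] (TopCoeff (β M) d l × ¬ l ≈ 0# × Pf.da ℕ.+ d ℕ.+ d ≤ Pf.dc) → Constant (β M)
      β-constant (inj₁ β≡0)                   = 0# , degLt⇒top β≡0 z≤n
      β-constant (inj₂ (dβ , l , tβ , _ , le)) =
        l , top-subst (a+x+x≤a⇒x≡0 Pf.da dβ (ℕP.≤-trans le (ℕP.≤-reflexive (≡.sym da≡dc)))) tβ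

    degrees-preserved : Shape → Pf′.da ≡ Pf.da × Pf′.dc ≡ Pf.dc
    degrees-preserved (balanced _ a′≡a c′≡c _ _ _ _)           = a′≡a , c′≡c
    degrees-preserved (upper-triangular _ a′≡a c′≡c _ _ _)     = a′≡a , c′≡c

  coeff-*-const² : ∀ P Q₁ Q₂ {l₁ l₂} n → TopCoeff Q₁ 0 l₁ → TopCoeff Q₂ 0 l₂ → coeff (P *ₚ Q₁ *ₚ Q₂) n ≈ coeff P n * (l₁ * l₂)
  coeff-*-const² P Q₁ Q₂ {l₁} {l₂} n t₁ t₂ =
    trans (coeff-*-const (P *ₚ Q₁) Q₂ l₂ n t₂) (trans (*-congʳ (coeff-*-const P Q₁ l₁ n t₁)) (*-assoc _ _ _))

  diagonal-action : ∀ f M {a d} → DegLt (β M) 0 → DegLt (γ M) 0 → TopCoeff (α M) 0 a → TopCoeff (δ M) 0 d →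
      (∀ n → coeff (A (f ∘F M)) n ≈ coeff (A f) n * (a * a))
    × (∀ n → coeff (B (f ∘F M)) n ≈ coeff (B f) n * (a * d))
    × (∀ n → coeff (C (f ∘F M)) n ≈ coeff (C f) n * (d * d))
  diagonal-action f M {a} {d} β≡0 γ≡0 tα tδ = A-scaled , B-scaled , C-scaled
    where
    A-scaled : ∀ n → coeff (A (f ∘F M)) n ≈ coeff (A f) n * (a * a)
    A-scaled n = begin
      coeff (A (f ∘F M)) n
        ≈⟨ coeff-+₃ (A f *ₚ α M *ₚ α M) (B f *ₚ α M *ₚ γ M) (C f *ₚ γ M *ₚ γ M) n ⟩
      coeff (A f *ₚ α M *ₚ α M) n + coeff (B f *ₚ α M *ₚ γ M) n + coeff (C f *ₚ γ M *ₚ γ M) n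
        ≈⟨ +-cong (+-congˡ (vanish (zero-*ₚʳ (B f *ₚ α M) (γ M) γ≡0) n z≤n)) (vanish (zero-*ₚʳ (C f *ₚ γ M) (γ M) γ≡0) n z≤n) ⟩
      coeff (A f *ₚ α M *ₚ α M) n + 0# + 0#
        ≈⟨ trans (+-identityʳ _) (+-identityʳ _) ⟩
      coeff (A f *ₚ α M *ₚ α M) n
        ≈⟨ coeff-*-const² (A f) (α M) (α M) n tα tα ⟩
      coeff (A f) n * (a * a) ∎

    middle : TopCoeff (α M *ₚ δ M +ₚ β M *ₚ γ M) 0 (a * d)
    middle = top-≈ (+-identityʳ _) (top-+ (top-* tα tδ) (degLt⇒top (zero-*ₚʳ (β M) (γ M) γ≡0) z≤n))

    B-scaled : ∀ n → coeff (B (f ∘F M)) n ≈ coeff (B f) n * (a * d)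
    B-scaled n = begin
      coeff (B (f ∘F M)) n
        ≈⟨ coeff-+₃ (two *ₚ A f *ₚ α M *ₚ β M) (B f *ₚ (α M *ₚ δ M +ₚ β M *ₚ γ M)) (two *ₚ C f *ₚ γ M *ₚ δ M) n ⟩
      coeff (two *ₚ A f *ₚ α M *ₚ β M) n + coeff (B f *ₚ (α M *ₚ δ M +ₚ β M *ₚ γ M)) n + coeff (two *ₚ C f *ₚ γ M *ₚ δ M) n
        ≈⟨ +-cong (+-congʳ (vanish (zero-*ₚʳ (two *ₚ A f *ₚ α M) (β M) β≡0) n z≤n))
                  (vanish (zero-*ₚˡ (two *ₚ C f *ₚ γ M) (δ M) (zero-*ₚʳ (two *ₚ C f) (γ M) γ≡0)) n z≤n) ⟩
      0# + coeff (B f *ₚ (α M *ₚ δ M +ₚ β M *ₚ γ M)) n + 0#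
        ≈⟨ trans (+-identityʳ _) (+-identityˡ _) ⟩
      coeff (B f *ₚ (α M *ₚ δ M +ₚ β M *ₚ γ M)) n
        ≈⟨ coeff-*-const (B f) _ (a * d) n middle ⟩
      coeff (B f) n * (a * d) ∎

    C-scaled : ∀ n → coeff (C (f ∘F M)) n ≈ coeff (C f) n * (d * d)
    C-scaled n = begin
      coeff (C (f ∘F M)) n
        ≈⟨ coeff-+₃ (A f *ₚ β M *ₚ β M) (B f *ₚ β M *ₚ δ M) (C f *ₚ δ M *ₚ δ M) n ⟩
      coeff (A f *ₚ β M *ₚ β M) n + coeff (B f *ₚ β M *ₚ δ M) n + coeff (C f *ₚ δ M *ₚ δ M) n
        ≈⟨ +-congʳ (+-cong (vanish (zero-*ₚʳ (A f *ₚ β M) (β M) β≡0) n z≤n)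
                           (vanish (zero-*ₚˡ (B f *ₚ β M) (δ M) (zero-*ₚʳ (B f) (β M) β≡0)) n z≤n)) ⟩
      0# + 0# + coeff (C f *ₚ δ M *ₚ δ M) n
        ≈⟨ trans (+-congʳ (+-identityʳ _)) (+-identityˡ _) ⟩
      coeff (C f *ₚ δ M *ₚ δ M) n
        ≈⟨ coeff-*-const² (C f) (δ M) (δ M) n tδ tδ ⟩
      coeff (C f) n * (d * d) ∎

  identity : Mat
  identity = mat (const 1#) [] [] (const 1#)

  det-identity : det identity ≈ₚ const 1#
  det-identity = top₀⇒≈const (top-≈ (trans (+-congˡ -0#≈0#) (trans (+-identityʳ _) (*-identityʳ 1#)))
    (top-+ (top-* (top-const 1#) (top-const 1#)) (top-neg (degLt⇒top {[]} (degLt λ _ _ → refl) z≤n))))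

  ≈F⇒equivalent : ∀ {f f′} → f ≈F f′ → Equivalent f f′
  ≈F⇒equivalent {f} {f′} (A≈ , B≈ , C≈)
    with diagonal-action f identity (degLt λ _ _ → refl) (degLt λ _ _ → refl) (top-const 1#) (top-const 1#)
  ... | A-scaled , B-scaled , C-scaled =
    identity , (1# , 1≉0 , det-identity) , scaled (A f) (A f′) (A (f ∘F identity)) A≈ A-scaled ,
    scaled (B f) (B f′) (B (f ∘F identity)) B≈ B-scaled , scaled (C f) (C f′) (C (f ∘F identity)) C≈ C-scaled
    where
    scaled : ∀ P P′ Q → P ≈ₚ P′ → (∀ n → coeff Q n ≈ coeff P n * (1# * 1#)) → P′ ≈ₚ Q
    scaled _ _ _ P≈P′ Q≈P n = sym (trans (Q≈P n) (trans (*-congˡ (*-identityʳ 1#)) (trans (*-identityʳ _) (P≈P′ n))))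

  absLt⇒da<dc : ∀ {f} (pf : Profile f) → AbsLt (A f) (C f) → Profile.da pf ℕ.< Profile.dc pf
  absLt⇒da<dc {f} pf (m , n , absA , absC , m<n) = q^-cancelʳ-<
    (≡.subst₂ ℕ._<_ (abs-deg {A f} (top⇒deg topA sA≉0) absA) (abs-deg {C f} (top⇒deg topC sC≉0) absC) m<n)
    where open Profile pf

  absEq⇒da≡dc : ∀ {f} (pf : Profile f) → AbsEq (A f) (C f) → Profile.da pf ≡ Profile.dc pf
  absEq⇒da≡dc {f} pf (m , n , absA , absC , m≡n) = q^-injective
    (≡.trans (≡.sym (abs-deg {A f} (top⇒deg topA sA≉0) absA)) (≡.trans m≡n (abs-deg {C f} (top⇒deg topC sC≉0) absC)))
    where open Profile pf

  sA-normalised : ∀ {f} (pf : Profile f) → PartiallyReduced f → AbsLt (A f) (C f) → Profile.sA pf ≈ 1# ⊎ Profile.sA pf ≈ h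
  sA-normalised {f} pf (_ , _ , normalised , _ , _) |A|<|C| with normalised |A|<|C|
  ... | inj₁ sgn≡1 = inj₁ (sgn-top (A f) (Profile.topA pf) (Profile.sA≉0 pf) sgn≡1)
  ... | inj₂ sgn≡h = inj₂ (sgn-top (A f) (Profile.topA pf) (Profile.sA≉0 pf) sgn≡h)

  sA≈1 : ∀ {f} (pf : Profile f) → PartiallyReduced f → AbsEq (A f) (C f) → Profile.sA pf ≈ 1#
  sA≈1 {f} pf (_ , _ , _ , monic , _) |A|≡|C| = sgn-top (A f) (Profile.topA pf) (Profile.sA≉0 pf) (monic |A|≡|C|)

  -- With deg A = deg C the discriminant has even degree, so it is unusual and its sign is the non-square h.
  h≈-4sAsC : ∀ {f} (pf : Profile f) → Standing f → Profile.da pf ≡ Profile.dc pf → h ≈ - (natC 4 * Profile.sA pf * Profile.sC pf)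
  h≈-4sAsC {f} pf (_ , _ , _ , _ , sgnD , kind) da≡dc = from-sign sgnD kind
    where
    open Profile pf
    from-sign : Sgn (Disc f) 1# ⊎ Sgn (Disc f) h → Imaginary f ⊎ Unusual f → h ≈ - (natC 4 * sA * sC)
    from-sign _ (inj₁ (d , dg , k , d≡odd)) = ⊥-elim (odd≢even k da
      (≡.trans (≡.cong (λ x → suc (k ℕ.+ x)) (≡.sym (ℕP.+-identityʳ k)))
      (≡.trans (≡.sym d≡odd) (≡.trans (degDisc≡ dg) (≡.cong (da ℕ.+_) (≡.sym da≡dc))))))
    from-sign (inj₂ sgn≡h) _ = sym (sgn-top (Disc f) topDisc (-4sAsC≉0 sA≉0 sC≉0) sgn≡h)
    from-sign (inj₁ sgn≡1) (inj₂ (d , dg , _ , _ , nonsquare)) = ⊥-elim (nonsquare (1# , trans (*-identityˡ 1#) (sym D≈1)))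
      where
      D≈1 : coeff (Disc f) d ≈ 1#
      D≈1 = trans (reflexive (≡.cong (coeff (Disc f)) (degDisc≡ dg)))
                  (trans (proj₂ topDisc) (sgn-top (Disc f) topDisc (-4sAsC≉0 sA≉0 sC≉0) sgn≡1))

  -- h is not a square, so a square factor l² can only move s ∈ {1, h} inside {1, h} if l² = 1.
  normalised-square≈1 : ∀ {s l} → ¬ l ≈ 0# → s ≈ 1# ⊎ s ≈ h → s * l * l ≈ 1# ⊎ s * l * l ≈ h → l * l ≈ 1#
  normalised-square≈1 {s} {l} _ (inj₁ s≈1) (inj₁ sll≈1) = trans (sym (trans (*-assoc _ _ _) (trans (*-congʳ s≈1) (*-identityˡ _)))) sll≈1
  normalised-square≈1 {s} {l} _ (inj₁ s≈1) (inj₂ sll≈h) =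
    ⊥-elim (h-nonsquare (l , trans (sym (trans (*-assoc _ _ _) (trans (*-congʳ s≈1) (*-identityˡ _)))) sll≈h))
  normalised-square≈1 {s} {l} l≉0 (inj₂ s≈h) (inj₁ sll≈1) = ⊥-elim (h-nonsquare (l ⁻¹ , (begin
      l ⁻¹ * l ⁻¹                          ≈⟨ sym (*-identityˡ _) ⟩
      1# * (l ⁻¹ * l ⁻¹)                   ≈⟨ *-congʳ (sym sll≈1) ⟩
      (s * l * l) * (l ⁻¹ * l ⁻¹)          ≈⟨ solve 3 (λ s l l⁻¹ → ((s :* l :* l) :* (l⁻¹ :* l⁻¹)) := (s :* (l :* l⁻¹) :* (l :* l⁻¹))) refl s l (l ⁻¹) ⟩
      s * (l * l ⁻¹) * (l * l ⁻¹)          ≈⟨ *-cong (*-congˡ (inverse l l≉0)) (inverse l l≉0) ⟩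
      s * 1# * 1#                          ≈⟨ trans (*-identityʳ _) (trans (*-identityʳ _) s≈h) ⟩
      h                                    ∎)))
  normalised-square≈1 {s} {l} _ (inj₂ s≈h) (inj₂ sll≈h) = *-cancelˡ h≉0 (begin
      h * (l * l)     ≈⟨ *-congʳ (sym s≈h) ⟩
      s * (l * l)     ≈⟨ sym (*-assoc _ _ _) ⟩
      s * l * l       ≈⟨ sll≈h ⟩
      h               ≈⟨ sym (*-identityʳ h) ⟩
      h * 1#          ∎)

  InS-resp-≈ : ∀ {x y} → x ≈ y → InS x → InS y
  InS-resp-≈ x≈y (i , i≤ , x≈hⁱ) = i , i≤ , trans (sym x≈y) x≈hⁱ

  x*1-y*0≈x : ∀ x y → x * 1# - y * 0# ≈ x
  x*1-y*0≈x x y = trans (+-cong (*-identityʳ x) (trans (-‿cong (zeroʳ y)) -0#≈0#)) (+-identityʳ x)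

  -- A constant M with f ∘ M ≈ f preserves the top form x² + s y², where s = −h/4.
  module IsometryEquations (a b g d u s : Carrier)
         (eq₁ : a * a + s * g * g ≈ 1#) (eq₂ : a * b + s * g * d ≈ 0#) (eq₃ : b * b + s * d * d ≈ s)
         (det≈u : a * d - b * g ≈ u) (h≈-4s : h ≈ - (natC 4 * s)) (s≉0 : ¬ s ≈ 0#) where

    -4s/h≈1 : - (natC 4 * s) * h ⁻¹ ≈ 1#
    -4s/h≈1 = trans (*-congʳ (sym h≈-4s)) (inverse h h≉0)

    d≈ua : d ≈ u * a
    d≈ua = sym (begin
      u * a                                              ≈⟨ *-congʳ (sym det≈u) ⟩
      (a * d - b * g) * a                                ≈⟨ solve 5 (λ a b g d s → ((a :* d :- b :* g) :* a) :=
                                                              (d :* (a :* a :+ s :* g :* g) :- g :* (a :* b :+ s :* g :* d))) refl a b g d s ⟩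
      d * (a * a + s * g * g) - g * (a * b + s * g * d)  ≈⟨ +-cong (*-congˡ eq₁) (-‿cong (*-congˡ eq₂)) ⟩
      d * 1# - g * 0#                                    ≈⟨ x*1-y*0≈x d g ⟩
      d                                                  ∎)

    b≈-sgu : b ≈ - (s * g * u)
    b≈-sgu = sym (begin
      - (s * g * u)                                      ≈⟨ -‿cong (*-congˡ (sym det≈u)) ⟩
      - (s * g * (a * d - b * g))                        ≈⟨ solve 5 (λ a b g d s → (:- (s :* g :* (a :* d :- b :* g))) :=
                                                              (b :* (a :* a :+ s :* g :* g) :- a :* (a :* b :+ s :* g :* d))) refl a b g d s ⟩
      b * (a * a + s * g * g) - a * (a * b + s * g * d)  ≈⟨ +-cong (*-congˡ eq₁) (-‿cong (*-congˡ eq₂)) ⟩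
      b * 1# - a * 0#                                    ≈⟨ x*1-y*0≈x b a ⟩
      b                                                  ∎)

    u*u≈1 : u * u ≈ 1#
    u*u≈1 = *-cancelˡ s≉0 (begin
      s * (u * u)                                        ≈⟨ sym (*-identityʳ _) ⟩
      s * (u * u) * 1#                                   ≈⟨ *-congˡ (sym eq₁) ⟩
      s * (u * u) * (a * a + s * g * g)                  ≈⟨ solve 4 (λ a g u s → (s :* (u :* u) :* (a :* a :+ s :* g :* g)) :=
                                                              ((:- (s :* g :* u)) :* (:- (s :* g :* u)) :+ s :* (u :* a) :* (u :* a))) refl a g u s ⟩
      - (s * g * u) * - (s * g * u) + s * (u * a) * (u * a) ≈⟨ +-cong (*-cong (sym b≈-sgu) (sym b≈-sgu)) (*-cong (*-congˡ (sym d≈ua)) (sym d≈ua)) ⟩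
      b * b + s * d * d                                  ≈⟨ eq₃ ⟩
      s                                                  ≈⟨ sym (*-identityʳ s) ⟩
      s * 1#                                             ∎)

    g≈4ub/h : g ≈ natC 4 * u * b * h ⁻¹
    g≈4ub/h = sym (begin
      natC 4 * u * b * h ⁻¹                              ≈⟨ *-congʳ (*-congˡ b≈-sgu) ⟩
      natC 4 * u * - (s * g * u) * h ⁻¹                  ≈⟨ solve 4 (λ g u s h⁻¹ → (con (+ 4) :* u :* (:- (s :* g :* u)) :* h⁻¹) :=
                                                              (g :* ((:- (con (+ 4) :* s)) :* h⁻¹) :* (u :* u))) refl g u s (h ⁻¹) ⟩
      g * (- (natC 4 * s) * h ⁻¹) * (u * u)              ≈⟨ *-cong (*-congˡ -4s/h≈1) u*u≈1 ⟩
      g * 1# * 1#                                        ≈⟨ trans (*-identityʳ _) (*-identityʳ _) ⟩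
      g                                                  ∎)

    norm≈1 : a * a - natC 4 * h ⁻¹ * (b * b) ≈ 1#
    norm≈1 = begin
      a * a - natC 4 * h ⁻¹ * (b * b)                    ≈⟨ +-congˡ (-‿cong (*-congˡ (*-cong b≈-sgu b≈-sgu))) ⟩
      a * a - natC 4 * h ⁻¹ * (- (s * g * u) * - (s * g * u)) ≈⟨ solve 5 (λ a g u s h⁻¹ →
            (a :* a :- con (+ 4) :* h⁻¹ :* ((:- (s :* g :* u)) :* (:- (s :* g :* u)))) :=
            (a :* a :+ ((:- (con (+ 4) :* s)) :* h⁻¹) :* (s :* g :* g) :* (u :* u))) refl a g u s (h ⁻¹) ⟩
      a * a + (- (natC 4 * s) * h ⁻¹) * (s * g * g) * (u * u) ≈⟨ +-congˡ (*-cong (*-congʳ -4s/h≈1) u*u≈1) ⟩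
      a * a + 1# * (s * g * g) * 1#                      ≈⟨ +-congˡ (trans (*-identityʳ _) (*-identityˡ _)) ⟩
      a * a + s * g * g                                  ≈⟨ eq₁ ⟩
      1#                                                 ∎

  module SpecialShapeValues (a b u sA s : Carrier) (u*u≈1 : u * u ≈ 1#) (h≈-4s : h ≈ - (natC 4 * s))
         (norm≈1 : a * a - natC 4 * h ⁻¹ * (b * b) ≈ 1#) (sA≈1 : sA ≈ 1#) where
    g : Carrier
    g = natC 4 * u * b * h ⁻¹

    -4s/h≈1 : - (natC 4 * s) * h ⁻¹ ≈ 1#
    -4s/h≈1 = trans (*-congʳ (sym h≈-4s)) (inverse h h≉0)

    A-top≈1 : sA * a * a + s * g * g ≈ 1#
    A-top≈1 = begin
      sA * a * a + s * g * g                             ≈⟨ solve 6 (λ a b u sA s h⁻¹ →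
            (sA :* a :* a :+ s :* (con (+ 4) :* u :* b :* h⁻¹) :* (con (+ 4) :* u :* b :* h⁻¹)) :=
            (sA :* (a :* a) :+ ((:- (con (+ 4) :* s)) :* h⁻¹) :* (:- (con (+ 4) :* h⁻¹ :* (b :* b))) :* (u :* u))) refl a b u sA s (h ⁻¹) ⟩
      sA * (a * a) + (- (natC 4 * s) * h ⁻¹) * - (natC 4 * h ⁻¹ * (b * b)) * (u * u)
                                                         ≈⟨ +-cong (*-congʳ sA≈1) (*-cong (*-congʳ -4s/h≈1) u*u≈1) ⟩
      1# * (a * a) + 1# * - (natC 4 * h ⁻¹ * (b * b)) * 1# ≈⟨ +-cong (*-identityˡ _) (trans (*-identityʳ _) (*-identityˡ _)) ⟩
      a * a - natC 4 * h ⁻¹ * (b * b)                    ≈⟨ norm≈1 ⟩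
      1#                                                 ∎

    B-top≈0 : natC 2 * sA * a * b + natC 2 * s * g * (u * a) ≈ 0#
    B-top≈0 = begin
      natC 2 * sA * a * b + natC 2 * s * g * (u * a)     ≈⟨ solve 6 (λ a b u sA s h⁻¹ →
            (con (+ 2) :* sA :* a :* b :+ con (+ 2) :* s :* (con (+ 4) :* u :* b :* h⁻¹) :* (u :* a)) :=
            ((con (+ 2) :* (a :* b)) :* sA :+ (con (+ 2) :* (a :* b)) :* (:- ((:- (con (+ 4) :* s)) :* h⁻¹)) :* (u :* u))) refl a b u sA s (h ⁻¹) ⟩
      X * sA + X * - (- (natC 4 * s) * h ⁻¹) * (u * u)  ≈⟨ +-cong (*-congˡ sA≈1) (*-cong (*-congˡ (-‿cong -4s/h≈1)) u*u≈1) ⟩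
      X * 1# + X * - 1# * 1#                             ≈⟨ +-cong (*-identityʳ X) (trans (*-identityʳ _) (x*-1≈-x X)) ⟩
      X - X                                              ≈⟨ -‿inverseʳ X ⟩
      0#                                                 ∎
      where X = natC 2 * (a * b)

    C-top≈s : sA * b * b + s * (u * a) * (u * a) ≈ s
    C-top≈s = begin
      sA * b * b + s * (u * a) * (u * a)                 ≈⟨ solve 5 (λ a b u sA s → (sA :* b :* b :+ s :* (u :* a) :* (u :* a)) :=
                                                              (sA :* (b :* b) :+ s :* (a :* a) :* (u :* u))) refl a b u sA s ⟩
      sA * (b * b) + s * (a * a) * (u * u)               ≈⟨ +-cong (*-congʳ sA≈1) (*-congˡ u*u≈1) ⟩
      1# * (b * b) + s * (a * a) * 1#                    ≈⟨ +-cong (*-identityˡ _) (*-identityʳ _) ⟩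
      b * b + s * (a * a)                                ≈⟨ +-comm _ _ ⟩
      s * (a * a) + b * b                                ≈⟨ +-congˡ (sym (trans (*-congʳ -4s/h≈1) (*-identityˡ _))) ⟩
      s * (a * a) + (- (natC 4 * s) * h ⁻¹) * (b * b)    ≈⟨ solve 4 (λ a b s h⁻¹ → (s :* (a :* a) :+ ((:- (con (+ 4) :* s)) :* h⁻¹) :* (b :* b)) :=
                                                              (s :* (a :* a :- con (+ 4) :* h⁻¹ :* (b :* b)))) refl a b s (h ⁻¹) ⟩
      s * (a * a - natC 4 * h ⁻¹ * (b * b))              ≈⟨ *-congˡ norm≈1 ⟩
      s * 1#                                             ≈⟨ *-identityʳ s ⟩
      s                                                  ∎

  -‿≉0 : ∀ {x} → ¬ x ≈ 0# → ¬ - x ≈ 0#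
  -‿≉0 {x} x≉0 -x≈0 = x≉0 (trans (sym (-‿involutive x)) (trans (-‿cong -x≈0) -0#≈0#))

  top-negated : ∀ {P Q d l} → (∀ n → coeff Q n ≈ - coeff P n) → TopCoeff P d l → TopCoeff Q d (- l)
  top-negated Q≈-P (degP , cP) =
    degLt (λ m le → trans (Q≈-P m) (trans (-‿cong (vanish degP m le)) -0#≈0#)) , trans (Q≈-P _) (-‿cong cP)

  -- S and −S are disjoint, so the sign condition on B rules out B′ = −B unless B = 0.
  negated-SgnInS⇒≈ : ∀ {P Q} → SgnInS P → SgnInS Q → (∀ n → coeff Q n ≈ - coeff P n) → P ≈ₚ Q
  negated-SgnInS⇒≈ {P} {Q} sgnP∈S sgnQ∈S Q≈-P with degView P
  ... | zeroPoly P≡0 = λ n → trans (vanish P≡0 n z≤n) (sym (trans (Q≈-P n) (trans (-‿cong (vanish P≡0 n z≤n)) -0#≈0#)))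
  ... | hasDeg d l tP l≉0
    with sgnP∈S (λ P≈0 → l≉0 (trans (sym (proj₂ tP)) (P≈0 d)))
       | sgnQ∈S (λ Q≈0 → -‿≉0 l≉0 (trans (sym (proj₂ (top-negated {P} {Q} Q≈-P tP))) (Q≈0 d)))
  ...   | s , sgnP≡s , s∈S | s′ , sgnQ≡s′ , s′∈S = ⊥-elim (¬InS-both l
          (InS-resp-≈ (sym (sgn-top P tP l≉0 sgnP≡s)) s∈S)
          (InS-resp-≈ (sym (sgn-top Q (top-negated {P} {Q} Q≈-P tP) (-‿≉0 l≉0) sgnQ≡s′)) s′∈S))

  module Comparison {f f′ : Form} (st : Standing f) (pr : PartiallyReduced f)
                    (pr′ : PartiallyReduced f′) (sameDisc : Disc f ≈ₚ Disc f′) (pf : Profile f) (pf′ : Profile f′) where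
    module Pf  = Profile pf
    module Pf′ = Profile pf′
    open SameDiscriminant pf pf′ sameDisc
    open Transformation pf pf′ sameDisc

    lt-eq-inequivalent : AbsLt (A f) (C f) → AbsEq (A f′) (C f′) → ¬ Equivalent f f′
    lt-eq-inequivalent |A|<|C| |A′|≡|C′| (M , M∈GL₂ , f′≈fM) with shape M M∈GL₂ f′≈fM
    ... | balanced da≡dc _ _ _ _ _ _ = ℕP.<-irrefl da≡dc (absLt⇒da<dc pf |A|<|C|)
    ... | upper-triangular _ a′≡a c′≡c _ _ _ =
      ℕP.<-irrefl (≡.trans (≡.sym a′≡a) (≡.trans (absEq⇒da≡dc pf′ |A′|≡|C′|) c′≡c)) (absLt⇒da<dc pf |A|<|C|)

    -- A nonzero β would put the coefficient 2 sA α β of B′ in degree deg A + deg β ≥ deg A′.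
    upper-triangular⇒β≡0 : ∀ M → f′ ≈F f ∘F M → DegLt (γ M) 0 → ∀ {a} → TopCoeff (α M) 0 a → ¬ a ≈ 0# →
                           ∀ {d} → TopCoeff (δ M) 0 d → Pf′.da ≡ Pf.da → ∀ {dβ l} → TopCoeff (β M) dβ l → ¬ l ≈ 0# → ⊥
    upper-triangular⇒β≡0 M f′≈fM γ≡0 {a} tα a≉0 tδ a′≡a {dβ} {l} tβ l≉0 =
      top≉0 (trans (sym (proj₂ top-B′)) (vanish Pf′.degB<da N (ℕP.≤-trans (ℕP.≤-reflexive a′≡a) (ℕP.m≤m+n Pf.da dβ))))
      where
      N = Pf.da ℕ.+ dβ
      top≉0 : ¬ natC 2 * Pf.sA * a * l + 0# + 0# ≈ 0#
      top≉0 = ≉0-resp-≈ (*-≉0 (*-≉0 (*-≉0 2≉0 Pf.sA≉0) a≉0) l≉0) (trans (+-identityʳ _) (+-identityʳ _))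
      top-B′ : TopCoeff (B f′) N (natC 2 * Pf.sA * a * l + 0# + 0#)
      top-B′ = top-≈ₚ (λ n → sym (proj₁ (proj₂ f′≈fM) n)) (top-+ (top-+
        (top-subst (≡.cong (ℕ._+ dβ) (ℕP.+-identityʳ Pf.da)) (top-* (top-* (top-* (top-const (natC 2)) Pf.topA) tα) tβ))
        (degLt⇒top (degLt-* (B f) (α M *ₚ δ M +ₚ β M *ₚ γ M) Pf.da 0 Pf.degB<da
                     (degLt-+ (proj₁ (top-* tα tδ)) (degLt-mono z≤n (zero-*ₚʳ (β M) (γ M) γ≡0))))
                   (ℕP.≤-trans (ℕP.≤-reflexive (ℕP.+-identityʳ Pf.da)) (ℕP.m≤m+n Pf.da dβ))))
        (degLt⇒top (zero-*ₚˡ (two *ₚ C f *ₚ γ M) (δ M) (zero-*ₚʳ (two *ₚ C f) (γ M) γ≡0)) z≤n))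

    diagonal⇒≈ : AbsLt (A f) (C f) → AbsLt (A f′) (C f′) → ∀ M → f′ ≈F f ∘F M → DegLt (β M) 0 → DegLt (γ M) 0 →
                 ∀ {a d} → TopCoeff (α M) 0 a → ¬ a ≈ 0# → TopCoeff (δ M) 0 d → Pf′.da ≡ Pf.da → Pf′.dc ≡ Pf.dc → f ≈F f′
    diagonal⇒≈ |A|<|C| |A′|<|C′| M f′≈fM β≡0 γ≡0 {a} {d} tα a≉0 tδ a′≡a c′≡c = A≈ , B≈ , C≈
      where
      scalings = diagonal-action f M β≡0 γ≡0 tα tδ
      A′-scaled : ∀ n → coeff (A f′) n ≈ coeff (A f) n * (a * a)
      A′-scaled n = trans (proj₁ f′≈fM n) (proj₁ scalings n)
      B′-scaled : ∀ n → coeff (B f′) n ≈ coeff (B f) n * (a * d)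
      B′-scaled n = trans (proj₁ (proj₂ f′≈fM) n) (proj₁ (proj₂ scalings) n)
      C′-scaled : ∀ n → coeff (C f′) n ≈ coeff (C f) n * (d * d)
      C′-scaled n = trans (proj₂ (proj₂ f′≈fM) n) (proj₂ (proj₂ scalings) n)

      sA′≈sA·a² : Pf′.sA ≈ Pf.sA * (a * a)
      sA′≈sA·a² = trans (sym (proj₂ Pf′.topA))
        (trans (A′-scaled Pf′.da) (*-congʳ (trans (reflexive (≡.cong (coeff (A f)) a′≡a)) (proj₂ Pf.topA))))
      sC′≈sC·d² : Pf′.sC ≈ Pf.sC * (d * d)
      sC′≈sC·d² = trans (sym (proj₂ Pf′.topC))
        (trans (C′-scaled Pf′.dc) (*-congʳ (trans (reflexive (≡.cong (coeff (C f)) c′≡c)) (proj₂ Pf.topC))))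

      a²≈1 : a * a ≈ 1#
      a²≈1 = normalised-square≈1 a≉0 (sA-normalised pf pr |A|<|C|)
        (map (trans (trans (*-assoc _ _ _) (sym sA′≈sA·a²))) (trans (trans (*-assoc _ _ _) (sym sA′≈sA·a²)))
             (sA-normalised pf′ pr′ |A′|<|C′|))

      d²≈1 : d * d ≈ 1#
      d²≈1 = *-cancelˡ (*-≉0 (*-≉0 4≉0 Pf.sA≉0) Pf.sC≉0) (begin
        natC 4 * Pf.sA * Pf.sC * (d * d)            ≈⟨ *-assoc _ _ _ ⟩
        natC 4 * Pf.sA * (Pf.sC * (d * d))          ≈⟨ *-cong (*-congˡ (sym (trans sA′≈sA·a² (trans (*-congˡ a²≈1) (*-identityʳ _)))))
                                                              (sym sC′≈sC·d²) ⟩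
        natC 4 * Pf′.sA * Pf′.sC                    ≈⟨ sym 4sAsC≈4sA′sC′ ⟩
        natC 4 * Pf.sA * Pf.sC                      ≈⟨ sym (*-identityʳ _) ⟩
        natC 4 * Pf.sA * Pf.sC * 1#                 ∎)

      ad·ad≈1 : (a * d) * (a * d) ≈ 1#
      ad·ad≈1 = trans (solve 2 (λ a d → (a :* d) :* (a :* d) := (a :* a) :* (d :* d)) refl a d)
                      (trans (*-cong a²≈1 d²≈1) (*-identityʳ 1#))

      A≈ : A f ≈ₚ A f′
      A≈ n = sym (trans (A′-scaled n) (trans (*-congˡ a²≈1) (*-identityʳ _)))
      C≈ : C f ≈ₚ C f′
      C≈ n = sym (trans (C′-scaled n) (trans (*-congˡ d²≈1) (*-identityʳ _)))
      B≈ : B f ≈ₚ B f′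
      B≈ with x*x≈1⇒x≈±1 ad·ad≈1
      ... | inj₁ ad≈1  = λ n → sym (trans (B′-scaled n) (trans (*-congˡ ad≈1) (*-identityʳ _)))
      ... | inj₂ ad≈-1 = negated-SgnInS⇒≈ {B f} {B f′} (proj₂ (proj₂ (proj₂ (proj₂ pr)))) (proj₂ (proj₂ (proj₂ (proj₂ pr′))))
                           λ n → trans (B′-scaled n) (trans (*-congˡ ad≈-1) (x*-1≈-x _))

    lt-lt-equivalent⇒≈ : AbsLt (A f) (C f) → AbsLt (A f′) (C f′) → Equivalent f f′ → f ≈F f′
    lt-lt-equivalent⇒≈ |A|<|C| |A′|<|C′| (M , M∈GL₂ , f′≈fM) with shape M M∈GL₂ f′≈fM
    ... | balanced da≡dc _ _ _ _ _ _ = ⊥-elim (ℕP.<-irrefl da≡dc (absLt⇒da<dc pf |A|<|C|))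
    ... | upper-triangular γ≡0 a′≡a _ (_ , tα , a≉0) (_ , tδ , _) (inj₂ (_ , _ , tβ , l≉0 , _)) =
      ⊥-elim (upper-triangular⇒β≡0 M f′≈fM γ≡0 tα a≉0 tδ a′≡a tβ l≉0)
    ... | upper-triangular γ≡0 a′≡a c′≡c (_ , tα , a≉0) (_ , tδ , _) (inj₁ β≡0) =
      diagonal⇒≈ |A|<|C| |A′|<|C′| M f′≈fM β≡0 γ≡0 tα a≉0 tδ a′≡a c′≡c

    eq-eq⇒special-shape : AbsEq (A f) (C f) → AbsEq (A f′) (C f′) → ∀ M → InGL2 M → f′ ≈F f ∘F M → SpecialShape (B f′) M
    eq-eq⇒special-shape |A|≡|C| |A′|≡|C′| M M∈GL₂ f′≈fM
      with constant-entries M M∈GL₂ f′≈fM (absEq⇒da≡dc pf |A|≡|C|) (shape M M∈GL₂ f′≈fM)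
         | degrees-preserved M M∈GL₂ f′≈fM (shape M M∈GL₂ f′≈fM)
    ... | (a , tα) , (b , tβ) , (g , tγ) , (d , tδ) | a′≡a , c′≡c =
      a , b , u , top₀⇒≈const tα , top₀⇒≈const tβ , top₀⇒≈const (top-≈ g≈4ub/h tγ) , top₀⇒≈const (top-≈ d≈ua tδ) ,
      norm≈1 , x*x≈1⇒x≈±1 u*u≈1 , proj₂ (proj₂ M∈GL₂) , proj₂ (proj₂ (proj₂ (proj₂ pr′)))
      where
      u = proj₁ M∈GL₂
      da≡dc = absEq⇒da≡dc pf |A|≡|C|
      sA≈1′ = sA≈1 pf pr |A|≡|C|
      sA′≈1 = sA≈1 pf′ pr′ |A′|≡|C′|
      open Values pf
      open ConstantAction tα tβ tγ tδ da≡dc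

      sAxy≈xy : ∀ x y → Pf.sA * x * y ≈ x * y
      sAxy≈xy x y = *-congʳ (trans (*-congʳ sA≈1′) (*-identityˡ x))

      sC≈sC′ : Pf.sC ≈ Pf′.sC
      sC≈sC′ = *-cancelˡ 4≉0 (trans (*-congʳ (sym (trans (*-congˡ sA≈1′) (*-identityʳ _))))
                              (trans 4sAsC≈4sA′sC′ (*-congʳ (trans (*-congˡ sA′≈1) (*-identityʳ _)))))

      eq₁ : a * a + Pf.sC * g * g ≈ 1#
      eq₁ = trans (+-congʳ (sym (sAxy≈xy a a)))
                  (trans (top-unique top-A∘M (top-subst a′≡a (top-≈ₚ (proj₁ f′≈fM) Pf′.topA))) sA′≈1)

      eq₂ : a * b + Pf.sC * g * d ≈ 0#
      eq₂ = *-cancelˡ 2≉0 (begin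
        natC 2 * (a * b + Pf.sC * g * d)             ≈⟨ *-congˡ (+-congʳ (sym (trans (sym (*-assoc _ _ _)) (sAxy≈xy a b)))) ⟩
        natC 2 * (Pf.sA * (a * b) + Pf.sC * g * d)   ≈⟨ solve 6 (λ sA sC a b g d → con (+ 2) :* (sA :* (a :* b) :+ sC :* g :* d) :=
                                                           con (+ 2) :* sA :* a :* b :+ con (+ 2) :* sC :* g :* d) refl Pf.sA Pf.sC a b g d ⟩
        natC 2 * Pf.sA * a * b + natC 2 * Pf.sC * g * d ≈⟨ top-unique top-B∘M (degLt⇒top B′<da ℕP.≤-refl) ⟩
        0#                                           ≈⟨ sym (zeroʳ _) ⟩
        natC 2 * 0#                                  ∎)
        where
        B′<da : DegLt (B (f ∘F M)) Pf.da
        B′<da = degLt-≈ₚ (proj₁ (proj₂ f′≈fM)) (≡.subst (DegLt (B f′)) a′≡a Pf′.degB<da)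

      eq₃ : b * b + Pf.sC * d * d ≈ Pf.sC
      eq₃ = trans (+-congʳ (sym (sAxy≈xy b b)))
              (trans (top-unique top-C∘M (top-subst (≡.trans c′≡c (≡.sym da≡dc)) (top-≈ₚ (proj₂ (proj₂ f′≈fM)) Pf′.topC)))
                     (sym sC≈sC′))

      det≈u : a * d - b * g ≈ u
      det≈u = trans (sym (+-cong (proj₂ (top-* tα tδ)) (-‿cong (proj₂ (top-* tβ tγ)))))
                    (trans (sym (coeff-- (α M *ₚ δ M) (β M *ₚ γ M) 0)) (proj₂ (proj₂ M∈GL₂) 0))

      h≈-4sC : h ≈ - (natC 4 * Pf.sC)
      h≈-4sC = trans (h≈-4sAsC pf st da≡dc) (-‿cong (*-congʳ (trans (*-congˡ sA≈1′) (*-identityʳ _))))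

      open IsometryEquations a b g d u Pf.sC eq₁ eq₂ eq₃ det≈u h≈-4sC Pf.sC≉0

  special-shape⇒reduced : ∀ {f} → Standing f → PartiallyReduced f → AbsEq (A f) (C f) →
                          ∀ M → SpecialShape (B (f ∘F M)) M →
                          InGL2 M × PartiallyReduced (f ∘F M) × AbsEq (A (f ∘F M)) (C (f ∘F M))
  special-shape⇒reduced {f} st pr |A|≡|C| M (a , b , u , α≈a , β≈b , γ≈g , δ≈ua , norm≈1 , u≈±1 , det≈u , sgnB′∈S) =
    (u , ±1≉0 u≈±1 , det≈u) ,
    (degLt⇒absLt {B g′} {A g′} B′<da degA′ , (_ , _ , deg⇒abs {A g′} degA′ , deg⇒abs {C g′} degC′ , ℕP.≤-refl) ,
     (λ _ → inj₁ sgnA′≡1) , (λ _ → sgnA′≡1) , sgnB′∈S) ,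
    (_ , _ , deg⇒abs {A g′} degA′ , deg⇒abs {C g′} degC′ , ≡.refl)
    where
    g′ = f ∘F M
    pf : Profile f
    pf = profile f st pr
    open Profile pf
    da≡dc = absEq⇒da≡dc pf |A|≡|C|
    sA≈1′ = sA≈1 pf pr |A|≡|C|
    h≈-4sC : h ≈ - (natC 4 * sC)
    h≈-4sC = trans (h≈-4sAsC pf st da≡dc) (-‿cong (*-congʳ (trans (*-congˡ sA≈1′) (*-identityʳ _))))
    open SpecialShapeValues a b u sA sC (±1*±1≈1 u≈±1) h≈-4sC norm≈1 sA≈1′
    open Values {f} pf
    open ConstantAction {M} (top-≈ₚ (λ n → sym (α≈a n)) (top-const a)) (top-≈ₚ (λ n → sym (β≈b n)) (top-const b))
                        (top-≈ₚ (λ n → sym (γ≈g n)) (top-const g)) (top-≈ₚ (λ n → sym (δ≈ua n)) (top-const (u * a))) da≡dc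
    degA′ : Deg (A g′) da
    degA′ = top⇒deg top-A∘M (≉0-resp-≈ 1≉0 A-top≈1)
    degC′ : Deg (C g′) da
    degC′ = top⇒deg top-C∘M (≉0-resp-≈ sC≉0 C-top≈s)
    B′<da : DegLt (B g′) da
    B′<da = top-0#⇒degLt top-B∘M B-top≈0
    sgnA′≡1 : Sgn (A g′) 1#
    sgnA′≡1 = top⇒sgn (A g′) top-A∘M (≉0-resp-≈ 1≉0 A-top≈1) A-top≈1

theorem3p3 : ∀ {c ℓ} (R : CommutativeRing c ℓ) (p k q : ℕ) → Prime p → 5 ≤ p → q ≡ p ^ k →
    (F : RingNotions.IsFiniteField R q) → RingNotions.HasChar R p →
    (h : CommutativeRing.Carrier R) → RingNotions.IsPrimitiveRoot R h →
    let open Forms R (RingNotions.IsFiniteField._⁻¹ F) q h in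
    (f f' : Form) → Standing f → Standing f' →
    PartiallyReduced f → PartiallyReduced f' → Disc f ≈ₚ Disc f' →
      ((AbsLt (A f) (C f) → AbsLt (A f') (C f') → (Equivalent f f' ⇔ f ≈F f'))
      × (AbsLt (A f) (C f) → AbsEq (A f') (C f') → ¬ Equivalent f f')
      × (AbsEq (A f) (C f) → AbsEq (A f') (C f') →
          ((∀ M → InGL2 M → f' ≈F f ∘F M → SpecialShape (B f') M)
          × (∀ M → SpecialShape (B (f ∘F M)) M →
               InGL2 M × PartiallyReduced (f ∘F M) × AbsEq (A (f ∘F M)) (C (f ∘F M))))))
theorem3p3 R p k q p-prime 5≤p q≡pᵏ F char-p h prim f f′ st st′ pr pr′ sameDisc =
    (λ |A|<|C| |A′|<|C′| → mk⇔ (lt-lt-equivalent⇒≈ |A|<|C| |A′|<|C′|) (≈F⇒equivalent {f} {f′}))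
  , lt-eq-inequivalent
  , (λ |A|≡|C| |A′|≡|C′| → eq-eq⇒special-shape |A|≡|C| |A′|≡|C′| , special-shape⇒reduced {f} st pr |A|≡|C|)
  where
  open ReducedForms R p k q p-prime 5≤p q≡pᵏ F char-p h prim
  open Comparison {f} {f′} st pr pr′ sameDisc (profile f st pr) (profile f′ st′ pr′)
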